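{- Let $p$ be a prime and $r\ge 0$ an integer. For a partition $\lambda$, let $|\lambda|$ be its size, $l(\lambda)$ its number of parts, $n(\lambda)=\sum_{i\ge1}(i-1)\lambda_i$, and $m_i(\lambda)$ the number of parts equal to $i$. Then \[ \lambda\mapsto \frac{\prod_{k=1}^r (1+1/p^k)^{ -1}}{p^{n(\lambda)+|\lambda|} \prod_{i \geq 1} \prod_{j=1}^{\lfloor m_i(\lambda)/2 \rfloor} (1-1/p^{2j})} \cdot \frac{(1-1/p) \cdots (1-1/p^r)}{(1-1/p) \cdots (1-1/p^{r-l(\lambda)})} \] defines a probability measure on the set of all partitions (of all natural numbers) with at most $r$ parts.
   Context: Empty products equal $1$. -}

module Defs where

open import Data.Nat as ℕ using (ℕ; zero; suc; _∸_; _^_)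
open import Data.Integer using (+_)
open import Data.List using (List; []; _∷_; length; foldr; map)
open import Data.List.Relation.Unary.All using (All)
open import Data.List.Relation.Unary.Linked using (Linked)
open import Data.Product using (_×_)
open import Relation.Nullary using (yes; no)
open import Data.Rational using (ℚ; 0ℚ; 1ℚ; _+_; _*_; _-_; 1/_; _/_; ≢-nonZero)
open import Data.Rational.Properties using (_≟_)

IsPartition : List ℕ → Set
IsPartition μ = Linked ℕ._≥_ μ × All (ℕ._≤_ 1) μ

PartitionAtMost : ℕ → List ℕ → Set
PartitionAtMost r μ = IsPartition μ × length μ ℕ.≤ r

size : List ℕ → ℕ
size = foldr ℕ._+_ 0

-- n(λ) = Σ_{i ≥ 1} (i-1) λ_i ; nAux k computes Σ (k + i - 1) λ_i
nAux : ℕ → List ℕ → ℕ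
nAux k []       = 0
nAux k (x ∷ xs) = k ℕ.* x ℕ.+ nAux (suc k) xs

nfun : List ℕ → ℕ
nfun = nAux 0

mult : ℕ → List ℕ → ℕ
mult i []       = 0
mult i (x ∷ xs) with x ℕ.≟ i
... | yes _ = suc (mult i xs)
... | no  _ = mult i xs

ofℕ : ℕ → ℚ
ofℕ n = + n / 1

-- total inverse on ℚ (inv 0 = 0; only applied to nonzero values below)
inv : ℚ → ℚ
inv x with x ≟ 0ℚ
... | yes _  = 0ℚ
... | no x≢0 = 1/_ x {{≢-nonZero x≢0}}

invPow : ℕ → ℕ → ℚ
invPow p k = inv (ofℕ (p ^ k))

prodFrom1 : ℕ → (ℕ → ℚ) → ℚ
prodFrom1 zero    f = 1ℚ
prodFrom1 (suc n) f = prodFrom1 n f * f (suc n)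

oneMinusProd : ℕ → ℕ → ℚ
oneMinusProd p n = prodFrom1 n (λ k → 1ℚ - invPow p k)

-- ∏_{i ≥ 1} ∏_{j=1}^{⌊m_i(λ)/2⌋} (1 - 1/p^{2j}); factors with i > |λ| are
-- empty products since then m_i(λ) = 0.
multProd : ℕ → List ℕ → ℚ
multProd p μ =
  prodFrom1 (size μ) (λ i → prodFrom1 (mult i μ ℕ./ 2) (λ j → 1ℚ - invPow p (2 ℕ.* j)))

weight : ℕ → ℕ → List ℕ → ℚ
weight p r μ =
  (inv (prodFrom1 r (λ k → 1ℚ + invPow p k))
    * inv (ofℕ (p ^ (nfun μ ℕ.+ size μ)) * multProd p μ))
  * (oneMinusProd p r * inv (oneMinusProd p (r ∸ length μ)))

sumℚ : List ℚ → ℚ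
sumℚ = foldr _+_ 0ℚ

-- Write t = 1/p. The weight of λ factors as L(l(λ)) · H(λ), where
-- L(a) = (t;t)_r / ((−t;t)_r (t;t)_(r−a)) and H(λ) = t^(n(λ)+|λ|) / ∏ᵢ (t²;t²)_⌊mᵢ/2⌋.
-- Deleting the first column of λ (of height a = l(λ)) leaves a partition of length a − k,
-- k = m₁(λ), and divides H by t^(a(a+1)/2) / (t²;t²)_⌊k/2⌋. Hence the H-masses v_N(a) of the
-- partitions of length a with parts at most N satisfy the positive linear recursion
-- v_{N+1}(a) = t^(a(a+1)/2) Σ_b v_N(b) h(a − b), with h(c) = 1/(t²;t²)_⌊c/2⌋. Its fixed
-- point is e(a) = t^(a(a+1)/2)/(t;t)_a, a q-series identity proved by a recurrence in a.
-- On lengths ≤ r the recursion contracts towards e with ratio 1 − (t;t)_r, so the total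
-- weight of the partitions with parts at most N tends to Σ_{a≤r} L(a) e(a), which equals 1
-- by the q-binomial theorem Σ_a t^(a(a+1)/2) [r choose a]_t = ∏_{k=1}^r (1 + t^k).

module Submission where

open import Defs
open import Data.Nat using (ℕ)
open import Data.Nat.Primality using (Prime)
open import Data.List using (List; map)
open import Data.List.Relation.Unary.All using (All)
open import Data.List.Relation.Unary.Unique.Propositional using (Unique)
open import Data.Product using (_×_; ∃-syntax)
open import Data.Rational using (ℚ; 0ℚ; 1ℚ; _-_; _≤_; _<_)

open import Algebra.Bundles using (CommutativeRing)
open import Data.Integer as ℤ using (+[1+_]; -[1+_]; +≤+)
import Data.Integer.Properties as ℤP
open import Data.List using ([]; _∷_; _++_; replicate; length)
import Data.List.Properties as ListP
open import Data.List.Membership.Propositional using (_∈_)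
open import Data.List.Membership.Propositional.Properties using (∈-map⁺; ∈-map⁻; ∈-++⁺ˡ; ∈-++⁺ʳ)
open import Data.List.Relation.Unary.All as All using ([]; _∷_)
import Data.List.Relation.Unary.All.Properties as AllP
import Data.List.Relation.Unary.AllPairs as AllPairs
open import Data.List.Relation.Unary.Any using (here; there; _─_)
open import Data.List.Relation.Unary.Linked as Linked using (Linked; []; [-]; _∷_)
import Data.List.Relation.Unary.Unique.Propositional.Properties as UniqueP
open import Data.Nat as ℕ using (zero; suc; z≤n; s≤s; _∸_)
import Data.Nat.Coprimality as Coprime
open import Data.Nat.DivMod using (m/n≡1+[m∸n]/n)
open import Data.Nat.Primality using (prime⇒nonTrivial)
import Data.Nat.Properties as ℕP
import Data.Nat.Solver as ℕSolver
open import Data.Product using (_,_; proj₁; proj₂)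
open import Data.Rational
open import Data.Rational.Properties
open import Data.Rational.Solver using (module +-*-Solver)
import Data.Rational.Unnormalised as ℚᵘ
import Data.Rational.Unnormalised.Properties as ℚᵘP
open import Data.Sum using (_⊎_; inj₁; inj₂)
open import Function using (_∘_)
open import Relation.Binary.PropositionalEquality
open import Relation.Nullary using (¬_; yes; no; contradiction)

open import Algebra.Properties.CommutativeSemiring.Exp
  (CommutativeRing.commutativeSemiring +-*-commutativeRing) using (_^_; ^-homo-*)
open +-*-Solver using (solve; _:*_; _:+_; _:-_; _:=_; con)
open ℕSolver.+-*-Solver using () renaming (solve to solveℕ; _:+_ to _⊕_; _:=_ to _≐_)

>0⇒≢0 : ∀ {x} → 0ℚ < x → x ≢ 0ℚ
>0⇒≢0 0<x = ≢-sym (<⇒≢ 0<x)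

*-nonNeg : ∀ {x y} → 0ℚ ≤ x → 0ℚ ≤ y → 0ℚ ≤ x * y
*-nonNeg {x} {y} 0≤x 0≤y =
  nonNegative⁻¹ _ {{nonNeg*nonNeg⇒nonNeg x {{nonNegative 0≤x}} y {{nonNegative 0≤y}}}}

*-pos : ∀ {x y} → 0ℚ < x → 0ℚ < y → 0ℚ < x * y
*-pos {x} {y} 0<x 0<y = positive⁻¹ _ {{pos*pos⇒pos x {{positive 0<x}} y {{positive 0<y}}}}

*-monoˡ-≤-0≤ : ∀ {r x y} → 0ℚ ≤ r → x ≤ y → r * x ≤ r * y
*-monoˡ-≤-0≤ {r} 0≤r = *-monoˡ-≤-nonNeg r {{nonNegative 0≤r}}

*-monoʳ-≤-0≤ : ∀ {r x y} → 0ℚ ≤ r → x ≤ y → x * r ≤ y * r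
*-monoʳ-≤-0≤ {r} 0≤r = *-monoʳ-≤-nonNeg r {{nonNegative 0≤r}}

x*y≤x : ∀ {x y} → 0ℚ ≤ x → y ≤ 1ℚ → x * y ≤ x
x*y≤x {x} {y} 0≤x y≤1 = subst (x * y ≤_) (*-identityʳ x) (*-monoˡ-≤-0≤ 0≤x y≤1)

p≤q⇒0≤q-p : ∀ {p q} → p ≤ q → 0ℚ ≤ q - p
p≤q⇒0≤q-p {p} {q} h = subst (_≤ q - p) (+-inverseʳ p) (+-monoˡ-≤ (- p) h)

0≤q-p⇒p≤q : ∀ {p q} → 0ℚ ≤ q - p → p ≤ q
0≤q-p⇒p≤q {p} {q} h = subst₂ _≤_ (+-identityˡ p) (solve 2 (λ q p → q :- p :+ p := q) refl q p) (+-monoˡ-≤ p h)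

p<q⇒0<q-p : ∀ {p q} → p < q → 0ℚ < q - p
p<q⇒0<q-p {p} {q} h = subst (_< q - p) (+-inverseʳ p) (+-monoˡ-< (- p) h)

inv-inverseˡ : ∀ {x} → x ≢ 0ℚ → inv x * x ≡ 1ℚ
inv-inverseˡ {x} x≢0 with x ≟ 0ℚ
... | yes x≡0 = contradiction x≡0 x≢0
... | no x≢0′ = *-inverseˡ x {{≢-nonZero x≢0′}}

inv-inverseʳ : ∀ {x} → x ≢ 0ℚ → x * inv x ≡ 1ℚ
inv-inverseʳ {x} x≢0 = trans (*-comm x _) (inv-inverseˡ x≢0)

inv-unique : ∀ x y → y * x ≡ 1ℚ → y ≡ inv x
inv-unique x y yx≡1 = begin
  y                    ≡⟨ *-identityʳ y ⟨
  y * 1ℚ               ≡⟨ cong (y *_) (inv-inverseʳ x≢0) ⟨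
  y * (x * inv x)      ≡⟨ *-assoc y x (inv x) ⟨
  (y * x) * inv x      ≡⟨ cong (_* inv x) yx≡1 ⟩
  1ℚ * inv x           ≡⟨ *-identityˡ (inv x) ⟩
  inv x                ∎
  where
  open ≡-Reasoning
  x≢0 : x ≢ 0ℚ
  x≢0 refl = 1≢0 (trans (sym yx≡1) (*-zeroʳ y))

inv-distrib-* : ∀ {x y} → x ≢ 0ℚ → y ≢ 0ℚ → inv (x * y) ≡ inv x * inv y
inv-distrib-* {x} {y} x≢0 y≢0 = sym (inv-unique (x * y) (inv x * inv y) (begin
  (inv x * inv y) * (x * y) ≡⟨ solve 4 (λ a b c d → (a :* b) :* (c :* d) := (a :* c) :* (b :* d)) refl (inv x) (inv y) x y ⟩
  (inv x * x) * (inv y * y) ≡⟨ cong₂ _*_ (inv-inverseˡ x≢0) (inv-inverseˡ y≢0) ⟩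
  1ℚ                        ∎))
  where open ≡-Reasoning

inv-pos : ∀ {x} → 0ℚ < x → 0ℚ < inv x
inv-pos {x} 0<x with x ≟ 0ℚ
... | yes x≡0 = contradiction x≡0 (>0⇒≢0 0<x)
... | no _ = positive⁻¹ _ {{1/pos⇒pos x {{positive 0<x}}}}

1≤inv : ∀ {x} → 0ℚ < x → x ≤ 1ℚ → 1ℚ ≤ inv x
1≤inv {x} 0<x x≤1 = subst₂ _≤_ (inv-inverseʳ (>0⇒≢0 0<x)) (*-identityˡ (inv x))
  (*-monoʳ-≤-0≤ (<⇒≤ (inv-pos 0<x)) x≤1)

ofℕ≡mkℚ : ∀ n → ofℕ n ≡ mkℚ (ℤ.+ n) 0 (Coprime.sym (Coprime.1-coprimeTo n))
ofℕ≡mkℚ n = normalize-coprime (Coprime.sym (Coprime.1-coprimeTo n))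

ofℕ-* : ∀ m n → ofℕ (m ℕ.* n) ≡ ofℕ m * ofℕ n
ofℕ-* m n rewrite ofℕ≡mkℚ m | ofℕ≡mkℚ n = cong (λ z → z / 1) (ℤP.pos-* m n)

ofℕ-^ : ∀ m n → ofℕ (m ℕ.^ n) ≡ ofℕ m ^ n
ofℕ-^ m zero    = refl
ofℕ-^ m (suc n) = trans (ofℕ-* m (m ℕ.^ n)) (cong (ofℕ m *_) (ofℕ-^ m n))

ofℕ-suc : ∀ n → ofℕ (suc n) ≡ ofℕ n + 1ℚ
ofℕ-suc n = trans (cong (_/ 1) numerator) (cong (_+ 1ℚ) (sym (ofℕ≡mkℚ n)))
  where
  -- ofℕ n + 1ℚ unfolds to (n * 1 + 1) / 1 once ofℕ n is rewritten to its normal form.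
  numerator : ℤ.+ suc n ≡ ℤ.+ n ℤ.* ℤ.+ 1 ℤ.+ ℤ.+ 1
  numerator = trans (cong ℤ.+_ (ℕP.+-comm 1 n)) (cong (ℤ._+ ℤ.+ 1) (sym (ℤP.*-identityʳ (ℤ.+ n))))

ofℕ-pos : ∀ {n} → 0 ℕ.< n → 0ℚ < ofℕ n
ofℕ-pos {suc n} _ rewrite ofℕ≡mkℚ (suc n) = positive⁻¹ _

ofℕ-nonNeg : ∀ n → 0ℚ ≤ ofℕ n
ofℕ-nonNeg zero    = ≤-refl
ofℕ-nonNeg (suc n) = <⇒≤ (ofℕ-pos {suc n} (s≤s z≤n))

1<ofℕ : ∀ {n} → 1 ℕ.< n → 1ℚ < ofℕ n
1<ofℕ {suc n} (s≤s 0<n) = subst₂ _<_ (+-identityˡ 1ℚ) (sym (ofℕ-suc n))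
  (+-monoˡ-< 1ℚ (ofℕ-pos 0<n))

archimedean : ∀ {x} → 0ℚ < x → ∃[ m ] 1ℚ ≤ ofℕ m * x
archimedean {mkℚ (ℤ.+ zero) _ _} (*<* (ℤ.+<+ ()))
archimedean {mkℚ -[1+ _ ] _ _} (*<* ())
-- x = (n + 1)/(d + 1), so (d + 1) x ≥ 1.
archimedean {x@(mkℚ +[1+ n ] d _)} _ = suc d , subst (λ z → 1ℚ ≤ z * x) (sym (ofℕ≡mkℚ (suc d)))
  (toℚᵘ-cancel-≤ (ℚᵘP.≤-respʳ-≃ (ℚᵘP.≃-sym (toℚᵘ-homo-* (mkℚ (ℤ.+ suc d) 0 (Coprime.sym (Coprime.1-coprimeTo (suc d)))) x)) (ℚᵘ.*≤* (+≤+ (s≤s d≤[n+d*[1+n]]*1)))))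
  where
  d≤[n+d*[1+n]]*1 : d ℕ.+ 0 ℕ.+ 0 ℕ.≤ (n ℕ.+ d ℕ.* suc n) ℕ.* 1
  d≤[n+d*[1+n]]*1 = begin
    d ℕ.+ 0 ℕ.+ 0          ≡⟨ trans (ℕP.+-identityʳ _) (ℕP.+-identityʳ d) ⟩
    d                      ≤⟨ ℕP.m≤m*n d (suc n) ⟩
    d ℕ.* suc n            ≤⟨ ℕP.m≤n+m _ n ⟩
    n ℕ.+ d ℕ.* suc n      ≡⟨ ℕP.*-identityʳ _ ⟨
    (n ℕ.+ d ℕ.* suc n) ℕ.* 1 ∎
    where open ℕP.≤-Reasoning

^-pos : ∀ {x} n → 0ℚ < x → 0ℚ < x ^ n
^-pos zero    _   = positive⁻¹ 1ℚ
^-pos (suc n) 0<x = *-pos 0<x (^-pos n 0<x)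

^-nonNeg : ∀ {x} n → 0ℚ ≤ x → 0ℚ ≤ x ^ n
^-nonNeg zero    _   = nonNegative⁻¹ 1ℚ
^-nonNeg (suc n) 0≤x = *-nonNeg 0≤x (^-nonNeg n 0≤x)

^-≤1 : ∀ {x} n → 0ℚ ≤ x → x ≤ 1ℚ → x ^ n ≤ 1ℚ
^-≤1 zero    _   _   = ≤-refl
^-≤1 {x} (suc n) 0≤x x≤1 = ≤-trans (x*y≤x 0≤x (^-≤1 n 0≤x x≤1)) x≤1

^-suc<1 : ∀ {x} n → 0ℚ ≤ x → x < 1ℚ → x ^ suc n < 1ℚ
^-suc<1 n 0≤x x<1 = ≤-<-trans (x*y≤x 0≤x (^-≤1 n 0≤x (<⇒≤ x<1))) x<1

inv-^ : ∀ {x} n → 0ℚ < x → inv (x ^ n) ≡ inv x ^ n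
inv-^ zero    _   = refl
inv-^ {x} (suc n) 0<x = trans (inv-distrib-* (>0⇒≢0 0<x) (>0⇒≢0 (^-pos n 0<x))) (cong (inv x *_) (inv-^ n 0<x))

bernoulli : ∀ {q} → 0ℚ ≤ q → q ≤ 1ℚ → ∀ N → (1ℚ - q) ^ N * (1ℚ + ofℕ N * q) ≤ 1ℚ
bernoulli {q} 0≤q q≤1 zero = ≤-reflexive (solve 1 (λ q → con 1ℚ :* (con 1ℚ :+ con 0ℚ :* q) := con 1ℚ) refl q)
bernoulli {q} 0≤q q≤1 (suc N) = begin
  (1ℚ - q) ^ suc N * (1ℚ + ofℕ (suc N) * q) ≡⟨ cong (λ z → (1ℚ - q) ^ suc N * (1ℚ + z * q)) (ofℕ-suc N) ⟩
  (1ℚ - q) * ρᴺ * (1ℚ + (n + 1ℚ) * q)         ≡⟨ solve 3 (λ q ρᴺ n → (con 1ℚ :- q) :* ρᴺ :* (con 1ℚ :+ (n :+ con 1ℚ) :* q)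
                                                  := ρᴺ :* (con 1ℚ :+ n :* q) :- ρᴺ :* q :* q :* (n :+ con 1ℚ)) refl q ρᴺ n ⟩
  ρᴺ * (1ℚ + n * q) - ρᴺ * q * q * (n + 1ℚ)   ≤⟨ x-y≤x (*-nonNeg (*-nonNeg (*-nonNeg (^-nonNeg N (p≤q⇒0≤q-p q≤1)) 0≤q) 0≤q)
                                                      (+-mono-≤ (ofℕ-nonNeg N) (nonNegative⁻¹ 1ℚ))) ⟩
  ρᴺ * (1ℚ + n * q)                           ≤⟨ bernoulli 0≤q q≤1 N ⟩
  1ℚ                                          ∎
  where
  open ≤-Reasoning
  ρᴺ = (1ℚ - q) ^ N
  n = ofℕ N
  x-y≤x : ∀ {x y} → 0ℚ ≤ y → x - y ≤ x
  x-y≤x {x} {y} 0≤y = 0≤q-p⇒p≤q (subst (0ℚ ≤_) (solve 2 (λ x y → y := x :- (x :- y)) refl x y) 0≤y)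

geometric-small : ∀ {q ε} → 0ℚ < q → q ≤ 1ℚ → 0ℚ < ε → ∃[ N ] (1ℚ - q) ^ N < ε
geometric-small {q} {ε} 0<q q≤1 0<ε with archimedean (*-pos 0<q 0<ε)
... | m , 1≤mqε = m , *-cancelʳ-<-nonNeg y {{nonNegative (<⇒≤ 0<y)}} ρᵐy<εy
  where
  y = 1ℚ + ofℕ m * q
  0<y : 0ℚ < y
  0<y = +-mono-<-≤ (positive⁻¹ 1ℚ) (*-nonNeg (ofℕ-nonNeg m) (<⇒≤ 0<q))
  ρᵐy<εy : (1ℚ - q) ^ m * y < ε * y
  ρᵐy<εy = begin-strict
    (1ℚ - q) ^ m * y     ≤⟨ bernoulli (<⇒≤ 0<q) q≤1 m ⟩
    1ℚ                   ≡⟨ +-identityˡ 1ℚ ⟨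
    0ℚ + 1ℚ              <⟨ +-mono-<-≤ 0<ε 1≤mqε ⟩
    ε + ofℕ m * (q * ε)  ≡⟨ solve 3 (λ e m q → e :+ m :* (q :* e) := e :* (con 1ℚ :+ m :* q)) refl ε (ofℕ m) q ⟩
    ε * y                ∎
    where open ≤-Reasoning

prodFrom1-cong : ∀ n {f g : ℕ → ℚ} → (∀ k → f (suc k) ≡ g (suc k)) → prodFrom1 n f ≡ prodFrom1 n g
prodFrom1-cong zero    _   = refl
prodFrom1-cong (suc n) f≗g = cong₂ _*_ (prodFrom1-cong n f≗g) (f≗g n)

prodFrom1-pos : ∀ n {f : ℕ → ℚ} → (∀ k → 0ℚ < f (suc k)) → 0ℚ < prodFrom1 n f
prodFrom1-pos zero    _   = positive⁻¹ 1ℚ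
prodFrom1-pos (suc n) 0<f = *-pos (prodFrom1-pos n 0<f) (0<f n)

prodFrom1-nonNeg : ∀ n {f : ℕ → ℚ} → (∀ k → 0ℚ ≤ f (suc k)) → 0ℚ ≤ prodFrom1 n f
prodFrom1-nonNeg zero    _   = nonNegative⁻¹ 1ℚ
prodFrom1-nonNeg (suc n) 0≤f = *-nonNeg (prodFrom1-nonNeg n 0≤f) (0≤f n)

prodFrom1-antimono : ∀ {m n} {f : ℕ → ℚ} → (∀ k → 0ℚ ≤ f (suc k)) → (∀ k → f (suc k) ≤ 1ℚ) →
                     m ℕ.≤ n → prodFrom1 n f ≤ prodFrom1 m f
prodFrom1-antimono {f = f} 0≤f f≤1 m≤n = go (ℕP.≤⇒≤′ m≤n)
  where
  go : ∀ {m n} → m ℕ.≤′ n → prodFrom1 n f ≤ prodFrom1 m f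
  go ℕ.≤′-refl                  = ≤-refl
  go (ℕ.≤′-step {n} m≤′n) = ≤-trans (x*y≤x (prodFrom1-nonNeg n 0≤f) (f≤1 n)) (go m≤′n)

prodFrom1-≤1 : ∀ n {f : ℕ → ℚ} → (∀ k → 0ℚ ≤ f (suc k)) → (∀ k → f (suc k) ≤ 1ℚ) → prodFrom1 n f ≤ 1ℚ
prodFrom1-≤1 n 0≤f f≤1 = prodFrom1-antimono 0≤f f≤1 (z≤n {n})

prodFrom1-trailing-ones : ∀ {m n} {f : ℕ → ℚ} → (∀ i → m ℕ.< i → f i ≡ 1ℚ) →
                          m ℕ.≤ n → prodFrom1 n f ≡ prodFrom1 m f
prodFrom1-trailing-ones {m} {f = f} f≡1 m≤n = go (ℕP.≤⇒≤′ m≤n)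
  where
  go : ∀ {n} → m ℕ.≤′ n → prodFrom1 n f ≡ prodFrom1 m f
  go ℕ.≤′-refl            = refl
  go (ℕ.≤′-step m≤′n) = trans (cong₂ _*_ (go m≤′n) (f≡1 _ (s≤s (ℕP.≤′⇒≤ m≤′n)))) (*-identityʳ _)

prodFrom1-suc : ∀ n (f : ℕ → ℚ) → prodFrom1 (suc n) f ≡ f 1 * prodFrom1 n (f ∘ suc)
prodFrom1-suc zero    f = trans (*-identityˡ (f 1)) (sym (*-identityʳ (f 1)))
prodFrom1-suc (suc n) f = trans (cong (_* f (suc (suc n))) (prodFrom1-suc n f)) (*-assoc (f 1) _ _)

inv-prodFrom1-suc : ∀ n (f : ℕ → ℚ) → prodFrom1 n f ≢ 0ℚ → f (suc n) ≢ 0ℚ →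
                    f (suc n) * inv (prodFrom1 (suc n) f) ≡ inv (prodFrom1 n f)
inv-prodFrom1-suc n f P≢0 x≢0 = begin
  x * inv (P * x)         ≡⟨ cong (x *_) (inv-distrib-* P≢0 x≢0) ⟩
  x * (inv P * inv x)     ≡⟨ solve 3 (λ x x⁻¹ P⁻¹ → x :* (P⁻¹ :* x⁻¹) := (x :* x⁻¹) :* P⁻¹) refl x (inv x) (inv P) ⟩
  (x * inv x) * inv P     ≡⟨ cong (_* inv P) (inv-inverseʳ x≢0) ⟩
  1ℚ * inv P              ≡⟨ *-identityˡ (inv P) ⟩
  inv P                   ∎
  where
  open ≡-Reasoning
  P = prodFrom1 n f
  x = f (suc n)

-- Convolution of sequences

-- (f ⋆ g) a = Σ_{b + c = a} f b * g c
infixl 7 _⋆_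

_⋆_ : (ℕ → ℚ) → (ℕ → ℚ) → ℕ → ℚ
(f ⋆ g) zero    = f 0 * g 0
(f ⋆ g) (suc a) = f 0 * g (suc a) + (f ∘ suc ⋆ g) a

δ₀ : ℕ → ℚ
δ₀ zero    = 1ℚ
δ₀ (suc _) = 0ℚ

δ₀-nonNeg : ∀ a → 0ℚ ≤ δ₀ a
δ₀-nonNeg zero    = nonNegative⁻¹ 1ℚ
δ₀-nonNeg (suc a) = ≤-refl

⋆-cong : ∀ n {f f′ g g′ : ℕ → ℚ} → (∀ b → f b ≡ f′ b) → (∀ c → g c ≡ g′ c) → (f ⋆ g) n ≡ (f′ ⋆ g′) n
⋆-cong zero    f≗f′ g≗g′ = cong₂ _*_ (f≗f′ 0) (g≗g′ 0)
⋆-cong (suc n) f≗f′ g≗g′ = cong₂ _+_ (cong₂ _*_ (f≗f′ 0) (g≗g′ (suc n))) (⋆-cong n (f≗f′ ∘ suc) g≗g′)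

⋆-sucʳ : ∀ a (f g : ℕ → ℚ) → (f ⋆ g) (suc a) ≡ f (suc a) * g 0 + (f ⋆ g ∘ suc) a
⋆-sucʳ zero    f g = +-comm (f 0 * g 1) (f 1 * g 0)
⋆-sucʳ (suc a) f g rewrite ⋆-sucʳ a (f ∘ suc) g =
  solve 3 (λ x y z → x :+ (y :+ z) := y :+ (x :+ z)) refl
    (f 0 * g (suc (suc a))) (f (suc (suc a)) * g 0) ((f ∘ suc ⋆ g ∘ suc) a)

⋆-*ˡ : ∀ n k (f g : ℕ → ℚ) → ((λ b → k * f b) ⋆ g) n ≡ k * (f ⋆ g) n
⋆-*ˡ zero    k f g = *-assoc k (f 0) (g 0)
⋆-*ˡ (suc n) k f g rewrite ⋆-*ˡ n k (f ∘ suc) g =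
  solve 4 (λ k a b x → k :* a :* b :+ k :* x := k :* (a :* b :+ x)) refl k (f 0) (g (suc n)) ((f ∘ suc ⋆ g) n)

⋆-*ʳ : ∀ n k (f g : ℕ → ℚ) → (f ⋆ (λ c → k * g c)) n ≡ k * (f ⋆ g) n
⋆-*ʳ zero    k f g = solve 3 (λ k a b → a :* (k :* b) := k :* (a :* b)) refl k (f 0) (g 0)
⋆-*ʳ (suc n) k f g rewrite ⋆-*ʳ n k (f ∘ suc) g =
  solve 4 (λ k a b x → a :* (k :* b) :+ k :* x := k :* (a :* b :+ x)) refl k (f 0) (g (suc n)) ((f ∘ suc ⋆ g) n)

⋆-+ʳ : ∀ n (f g g′ : ℕ → ℚ) → (f ⋆ (λ c → g c + g′ c)) n ≡ (f ⋆ g) n + (f ⋆ g′) n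
⋆-+ʳ zero    f g g′ = *-distribˡ-+ (f 0) (g 0) (g′ 0)
⋆-+ʳ (suc n) f g g′ rewrite ⋆-+ʳ n (f ∘ suc) g g′ =
  solve 5 (λ a b c x y → a :* (b :+ c) :+ (x :+ y) := (a :* b :+ x) :+ (a :* c :+ y)) refl
    (f 0) (g (suc n)) (g′ (suc n)) ((f ∘ suc ⋆ g) n) ((f ∘ suc ⋆ g′) n)

⋆--ˡ : ∀ n (f f′ g : ℕ → ℚ) → ((λ b → f b - f′ b) ⋆ g) n ≡ (f ⋆ g) n - (f′ ⋆ g) n
⋆--ˡ zero    f f′ g = solve 3 (λ a b c → (a :- b) :* c := a :* c :- b :* c) refl (f 0) (f′ 0) (g 0)
⋆--ˡ (suc n) f f′ g rewrite ⋆--ˡ n (f ∘ suc) (f′ ∘ suc) g =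
  solve 5 (λ a b c x y → (a :- b) :* c :+ (x :- y) := (a :* c :+ x) :- (b :* c :+ y)) refl
    (f 0) (f′ 0) (g (suc n)) ((f ∘ suc ⋆ g) n) ((f′ ∘ suc ⋆ g) n)

⋆--ʳ : ∀ n (f g g′ : ℕ → ℚ) → (f ⋆ (λ c → g c - g′ c)) n ≡ (f ⋆ g) n - (f ⋆ g′) n
⋆--ʳ zero    f g g′ = solve 3 (λ a b c → a :* (b :- c) := a :* b :- a :* c) refl (f 0) (g 0) (g′ 0)
⋆--ʳ (suc n) f g g′ rewrite ⋆--ʳ n (f ∘ suc) g g′ =
  solve 5 (λ a b c x y → a :* (b :- c) :+ (x :- y) := (a :* b :+ x) :- (a :* c :+ y)) refl
    (f 0) (g (suc n)) (g′ (suc n)) ((f ∘ suc ⋆ g) n) ((f ∘ suc ⋆ g′) n)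

⋆-geometric : ∀ x n (f g : ℕ → ℚ) → ((λ b → x ^ b * f b) ⋆ (λ c → x ^ c * g c)) n ≡ x ^ n * (f ⋆ g) n
⋆-geometric x zero    f g = solve 2 (λ a b → (con 1ℚ :* a) :* (con 1ℚ :* b) := con 1ℚ :* (a :* b)) refl (f 0) (g 0)
⋆-geometric x (suc n) f g = begin
  u + ((λ b → x ^ suc b * f (suc b)) ⋆ xᶜg) n
    ≡⟨ cong (u +_) (trans (⋆-cong n (λ b → *-assoc x (x ^ b) (f (suc b))) (λ _ → refl))
                          (⋆-*ˡ n x (λ b → x ^ b * f (suc b)) xᶜg)) ⟩
  u + x * ((λ b → x ^ b * f (suc b)) ⋆ xᶜg) n
    ≡⟨ cong (λ z → u + x * z) (⋆-geometric x n (f ∘ suc) g) ⟩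
  u + x * (x ^ n * (f ∘ suc ⋆ g) n)
    ≡⟨ solve 5 (λ a x xⁿ b c → (con 1ℚ :* a) :* ((x :* xⁿ) :* b) :+ x :* (xⁿ :* c) := (x :* xⁿ) :* (a :* b :+ c)) refl
         (f 0) x (x ^ n) (g (suc n)) ((f ∘ suc ⋆ g) n) ⟩
  x ^ suc n * (f ⋆ g) (suc n) ∎
  where
  open ≡-Reasoning
  u = (1ℚ * f 0) * (x ^ suc n * g (suc n))
  xᶜg = λ c → x ^ c * g c

⋆-zeroˡ : ∀ a (g : ℕ → ℚ) → ((λ _ → 0ℚ) ⋆ g) a ≡ 0ℚ
⋆-zeroˡ zero    g = *-zeroˡ (g 0)
⋆-zeroˡ (suc a) g rewrite ⋆-zeroˡ a g = trans (+-identityʳ _) (*-zeroˡ (g (suc a)))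

⋆-identityˡ : ∀ a (g : ℕ → ℚ) → (δ₀ ⋆ g) a ≡ g a
⋆-identityˡ zero    g = *-identityˡ (g 0)
⋆-identityˡ (suc a) g = trans (cong (1ℚ * g (suc a) +_) (⋆-zeroˡ a g)) (trans (+-identityʳ _) (*-identityˡ _))

⋆-monoˡ : ∀ a {f f′ g : ℕ → ℚ} → (∀ b → b ℕ.≤ a → f b ≤ f′ b) → (∀ c → 0ℚ ≤ g c) → (f ⋆ g) a ≤ (f′ ⋆ g) a
⋆-monoˡ zero    f≤f′ 0≤g = *-monoʳ-≤-0≤ (0≤g 0) (f≤f′ 0 z≤n)
⋆-monoˡ (suc a) f≤f′ 0≤g =
  +-mono-≤ (*-monoʳ-≤-0≤ (0≤g (suc a)) (f≤f′ 0 z≤n)) (⋆-monoˡ a (λ b b≤a → f≤f′ (suc b) (s≤s b≤a)) 0≤g)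

⋆-nonNeg : ∀ a {f g : ℕ → ℚ} → (∀ b → b ℕ.≤ a → 0ℚ ≤ f b) → (∀ c → 0ℚ ≤ g c) → 0ℚ ≤ (f ⋆ g) a
⋆-nonNeg a {f} {g} 0≤f 0≤g = subst (_≤ (f ⋆ g) a) (⋆-zeroˡ a g) (⋆-monoˡ a 0≤f 0≤g)

shift : (ℕ → ℚ) → ℕ → ℚ
shift f zero    = 0ℚ
shift f (suc c) = f c

⋆-shift : ∀ a (f g : ℕ → ℚ) → (f ⋆ shift g) (suc a) ≡ (f ⋆ g) a
⋆-shift a f g = begin
  (f ⋆ shift g) (suc a)             ≡⟨ ⋆-sucʳ a f (shift g) ⟩
  f (suc a) * 0ℚ + (f ⋆ g) a        ≡⟨ cong (_+ (f ⋆ g) a) (*-zeroʳ (f (suc a))) ⟩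
  0ℚ + (f ⋆ g) a                    ≡⟨ +-identityˡ _ ⟩
  (f ⋆ g) a                         ∎
  where open ≡-Reasoning

sumUpTo : ℕ → (ℕ → ℚ) → ℚ
sumUpTo zero    s = s 0
sumUpTo (suc n) s = sumUpTo n s + s (suc n)

sumUpTo-cong : ∀ n {s s′ : ℕ → ℚ} → (∀ a → a ℕ.≤ n → s a ≡ s′ a) → sumUpTo n s ≡ sumUpTo n s′
sumUpTo-cong zero    s≗s′ = s≗s′ 0 z≤n
sumUpTo-cong (suc n) s≗s′ = cong₂ _+_ (sumUpTo-cong n (λ a a≤n → s≗s′ a (ℕP.m≤n⇒m≤1+n a≤n))) (s≗s′ (suc n) ℕP.≤-refl)

sumUpTo-mono : ∀ n {s s′ : ℕ → ℚ} → (∀ a → a ℕ.≤ n → s a ≤ s′ a) → sumUpTo n s ≤ sumUpTo n s′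
sumUpTo-mono zero    s≤s′ = s≤s′ 0 z≤n
sumUpTo-mono (suc n) s≤s′ = +-mono-≤ (sumUpTo-mono n (λ a a≤n → s≤s′ a (ℕP.m≤n⇒m≤1+n a≤n))) (s≤s′ (suc n) ℕP.≤-refl)

sumUpTo-*ˡ : ∀ n c (s : ℕ → ℚ) → sumUpTo n (λ a → c * s a) ≡ c * sumUpTo n s
sumUpTo-*ˡ zero    c s = refl
sumUpTo-*ˡ (suc n) c s rewrite sumUpTo-*ˡ n c s = sym (*-distribˡ-+ c (sumUpTo n s) (s (suc n)))

⋆≡sumUpTo : ∀ n (f g : ℕ → ℚ) → (f ⋆ g) n ≡ sumUpTo n (λ b → f b * g (n ∸ b))
⋆≡sumUpTo zero    f g = refl
⋆≡sumUpTo (suc n) f g = begin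
  (f ⋆ g) (suc n)                                       ≡⟨ ⋆-sucʳ n f g ⟩
  f (suc n) * g 0 + (f ⋆ g ∘ suc) n                     ≡⟨ cong (f (suc n) * g 0 +_) (⋆≡sumUpTo n f (g ∘ suc)) ⟩
  f (suc n) * g 0 + sumUpTo n (λ b → f b * g (suc (n ∸ b))) ≡⟨ +-comm (f (suc n) * g 0) _ ⟩
  sumUpTo n (λ b → f b * g (suc (n ∸ b))) + f (suc n) * g 0
    ≡⟨ cong₂ _+_ (sumUpTo-cong n (λ b b≤n → cong (λ z → f b * g z) (sym (ℕP.+-∸-assoc 1 b≤n))))
                 (cong (λ z → f (suc n) * g z) (sym (ℕP.n∸n≡0 n))) ⟩
  sumUpTo (suc n) (λ b → f b * g (suc n ∸ b))           ∎
  where open ≡-Reasoning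

consecutiveSum : ℕ → ℕ → ℕ
consecutiveSum j zero    = 0
consecutiveSum j (suc n) = j ℕ.+ consecutiveSum (suc j) n

consecutiveSum-+ : ∀ j m n → consecutiveSum j (m ℕ.+ n) ≡ consecutiveSum j m ℕ.+ consecutiveSum (j ℕ.+ m) n
consecutiveSum-+ j zero    n = cong (λ i → consecutiveSum i n) (sym (ℕP.+-identityʳ j))
consecutiveSum-+ j (suc m) n = begin
  j ℕ.+ consecutiveSum (suc j) (m ℕ.+ n)
    ≡⟨ cong (j ℕ.+_) (consecutiveSum-+ (suc j) m n) ⟩
  j ℕ.+ (consecutiveSum (suc j) m ℕ.+ consecutiveSum (suc j ℕ.+ m) n)
    ≡⟨ ℕP.+-assoc j _ _ ⟨
  j ℕ.+ consecutiveSum (suc j) m ℕ.+ consecutiveSum (suc j ℕ.+ m) n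
    ≡⟨ cong (λ i → j ℕ.+ consecutiveSum (suc j) m ℕ.+ consecutiveSum i n) (sym (ℕP.+-suc j m)) ⟩
  j ℕ.+ consecutiveSum (suc j) m ℕ.+ consecutiveSum (j ℕ.+ suc m) n ∎
  where open ≡-Reasoning

triangle : ℕ → ℕ
triangle = consecutiveSum 1

triangle-suc : ∀ n → triangle (suc n) ≡ triangle n ℕ.+ suc n
triangle-suc n = begin
  triangle (suc n)                       ≡⟨ cong triangle (ℕP.+-comm 1 n) ⟩
  consecutiveSum 1 (n ℕ.+ 1)             ≡⟨ consecutiveSum-+ 1 n 1 ⟩
  triangle n ℕ.+ (suc n ℕ.+ 0)           ≡⟨ cong (triangle n ℕ.+_) (ℕP.+-identityʳ (suc n)) ⟩
  triangle n ℕ.+ suc n                   ∎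
  where open ≡-Reasoning

[2+n]/2≡1+[n/2] : ∀ n → suc (suc n) ℕ./ 2 ≡ suc (n ℕ./ 2)
[2+n]/2≡1+[n/2] n = m/n≡1+[m∸n]/n {suc (suc n)} (s≤s (s≤s z≤n))

[m+m]/2≡m : ∀ m → (m ℕ.+ m) ℕ./ 2 ≡ m
[m+m]/2≡m zero    = refl
[m+m]/2≡m (suc m) = trans (cong (λ k → suc k ℕ./ 2) (ℕP.+-suc m m))
                          (trans ([2+n]/2≡1+[n/2] (m ℕ.+ m)) (cong suc ([m+m]/2≡m m)))

[1+m+m]/2≡m : ∀ m → suc (m ℕ.+ m) ℕ./ 2 ≡ m
[1+m+m]/2≡m zero    = refl
[1+m+m]/2≡m (suc m) = trans (cong (λ k → suc (suc k) ℕ./ 2) (ℕP.+-suc m m))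
                            (trans ([2+n]/2≡1+[n/2] (suc (m ℕ.+ m))) (cong suc ([1+m+m]/2≡m m)))

even⊎odd : ∀ c → (∃[ m ] c ≡ m ℕ.+ m) ⊎ (∃[ m ] c ≡ suc (m ℕ.+ m))
even⊎odd zero = inj₁ (0 , refl)
even⊎odd (suc c) with even⊎odd c
... | inj₁ (m , refl) = inj₂ (m , refl)
... | inj₂ (m , refl) = inj₁ (suc m , cong suc (sym (ℕP.+-suc m m)))

∈-─ : ∀ {A : Set} {x y : A} xs (x∈xs : x ∈ xs) → y ∈ xs → y ≢ x → y ∈ (xs ─ x∈xs)
∈-─ (z ∷ zs) (here refl)  (here refl)  y≢x = contradiction refl y≢x
∈-─ (z ∷ zs) (here refl)  (there y∈zs) _   = y∈zs
∈-─ (z ∷ zs) (there x∈zs) (here refl)  _   = here refl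
∈-─ (z ∷ zs) (there x∈zs) (there y∈zs) y≢x = there (∈-─ zs x∈zs y∈zs y≢x)

module _ {A : Set} (f : A → ℚ) where

  sumℚ-map-++ : ∀ xs ys → sumℚ (map f (xs ++ ys)) ≡ sumℚ (map f xs) + sumℚ (map f ys)
  sumℚ-map-++ []       ys = sym (+-identityˡ _)
  sumℚ-map-++ (x ∷ xs) ys = trans (cong (f x +_) (sumℚ-map-++ xs ys)) (sym (+-assoc (f x) _ _))

  sumℚ-map-scale : ∀ (g : A → ℚ) c {xs} → All (λ x → f x ≡ c * g x) xs → sumℚ (map f xs) ≡ c * sumℚ (map g xs)
  sumℚ-map-scale g c []          = sym (*-zeroʳ c)
  sumℚ-map-scale g c (fx≡cgx ∷ rest) =
    trans (cong₂ _+_ fx≡cgx (sumℚ-map-scale g c rest)) (sym (*-distribˡ-+ c _ _))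

  sumℚ-map-─ : ∀ {x} xs (x∈xs : x ∈ xs) → sumℚ (map f xs) ≡ f x + sumℚ (map f (xs ─ x∈xs))
  sumℚ-map-─ (y ∷ xs) (here refl)  = refl
  sumℚ-map-─ {x} (y ∷ xs) (there x∈xs) = trans (cong (f y +_) (sumℚ-map-─ xs x∈xs))
    (solve 3 (λ a b c → a :+ (b :+ c) := b :+ (a :+ c)) refl (f y) (f x) (sumℚ (map f (xs ─ x∈xs))))

  module _ (0≤f : ∀ x → 0ℚ ≤ f x) where

    sumℚ-map-nonNeg : ∀ xs → 0ℚ ≤ sumℚ (map f xs)
    sumℚ-map-nonNeg []       = ≤-refl
    sumℚ-map-nonNeg (x ∷ xs) = +-mono-≤ (0≤f x) (sumℚ-map-nonNeg xs)

    sumℚ-map-mono-⊆ : ∀ {xs ys} → Unique xs → (∀ {x} → x ∈ xs → x ∈ ys) → sumℚ (map f xs) ≤ sumℚ (map f ys)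
    sumℚ-map-mono-⊆ {[]}     {ys} _                  _     = sumℚ-map-nonNeg ys
    sumℚ-map-mono-⊆ {x ∷ xs} {ys} (x∉xs AllPairs.∷ unique) xs⊆ys =
      subst (sumℚ (map f (x ∷ xs)) ≤_) (sym (sumℚ-map-─ ys x∈ys))
        (+-monoʳ-≤ (f x) (sumℚ-map-mono-⊆ unique (λ y∈xs → ∈-─ ys x∈ys (xs⊆ys (there y∈xs)) (All.lookup x∉xs y∈xs ∘ sym))))
      where
      x∈ys = xs⊆ys (here refl)

-- The q-difference operator and the limiting length distribution

module QDifference (t : ℚ) where

  twist : (ℕ → ℚ) → ℕ → ℚ
  twist f b = t ^ b * f b

  ∂ : (ℕ → ℚ) → ℕ → ℚ
  ∂ f b = f b - t ^ b * f b

  ∂-zero : ∀ f → ∂ f 0 ≡ 0ℚ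
  ∂-zero f = solve 1 (λ x → x :- con 1ℚ :* x := con 0ℚ) refl (f 0)

  -- 1 - t^(b+c) = (1 - t^b) + t^b (1 - t^c)
  ∂-⋆ : ∀ n (f g : ℕ → ℚ) → ∂ (f ⋆ g) n ≡ (∂ f ⋆ g) n + (twist f ⋆ ∂ g) n
  ∂-⋆ n f g = begin
    (f ⋆ g) n - t ^ n * (f ⋆ g) n
      ≡⟨ cong (λ z → (f ⋆ g) n - z) (⋆-geometric t n f g) ⟨
    (f ⋆ g) n - (twist f ⋆ twist g) n
      ≡⟨ solve 3 (λ a b c → a :- c := (a :- b) :+ (b :- c)) refl ((f ⋆ g) n) ((twist f ⋆ g) n) ((twist f ⋆ twist g) n) ⟩
    ((f ⋆ g) n - (twist f ⋆ g) n) + ((twist f ⋆ g) n - (twist f ⋆ twist g) n)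
      ≡⟨ cong₂ _+_ (⋆--ˡ n f (twist f) g) (⋆--ʳ n (twist f) g (twist g)) ⟨
    (∂ f ⋆ g) n + (twist f ⋆ ∂ g) n ∎
    where open ≡-Reasoning

  ∂⋆-suc : ∀ a {f F : ℕ → ℚ} (G : ℕ → ℚ) → (∀ b → ∂ f (suc b) ≡ t * F b) → (∂ f ⋆ G) (suc a) ≡ t * (F ⋆ G) a
  ∂⋆-suc a {f} {F} G ∂f≡tF = begin
    ∂ f 0 * G (suc a) + (∂ f ∘ suc ⋆ G) a   ≡⟨ cong₂ (λ u v → u * G (suc a) + v) (∂-zero f)
                                                 (trans (⋆-cong a ∂f≡tF (λ _ → refl)) (⋆-*ˡ a t F G)) ⟩
    0ℚ * G (suc a) + t * (F ⋆ G) a          ≡⟨ solve 2 (λ x y → con 0ℚ :* x :+ y := y) refl (G (suc a)) (t * (F ⋆ G) a) ⟩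
    t * (F ⋆ G) a                            ∎
    where open ≡-Reasoning

module Series (t : ℚ) (0<t : 0ℚ < t) (t<1 : t < 1ℚ) where

  open QDifference t

  0≤t : 0ℚ ≤ t
  0≤t = <⇒≤ 0<t

  0<1-tˢ : ∀ k → 0ℚ < 1ℚ - t ^ suc k
  0<1-tˢ k = p<q⇒0<q-p (^-suc<1 k 0≤t t<1)

  1-tᵏ≤1 : ∀ k → 1ℚ - t ^ k ≤ 1ℚ
  1-tᵏ≤1 k = 0≤q-p⇒p≤q (subst (0ℚ ≤_) (solve 1 (λ x → x := con 1ℚ :- (con 1ℚ :- x)) refl (t ^ k)) (^-nonNeg k 0≤t))

  0<1-t²ˢ : ∀ j → 0ℚ < 1ℚ - t ^ (2 ℕ.* suc j)
  0<1-t²ˢ j = subst (λ k → 0ℚ < 1ℚ - t ^ k) (sym (ℕP.*-suc 2 j)) (0<1-tˢ (suc (2 ℕ.* j)))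

  poch : ℕ → ℚ
  poch n = prodFrom1 n (λ k → 1ℚ - t ^ k)

  evenPoch : ℕ → ℚ
  evenPoch m = prodFrom1 m (λ j → 1ℚ - t ^ (2 ℕ.* j))

  negPoch : ℕ → ℚ
  negPoch n = prodFrom1 n (λ k → 1ℚ + t ^ k)

  poch-pos : ∀ n → 0ℚ < poch n
  poch-pos n = prodFrom1-pos n 0<1-tˢ

  evenPoch-pos : ∀ m → 0ℚ < evenPoch m
  evenPoch-pos m = prodFrom1-pos m 0<1-t²ˢ

  negPoch-pos : ∀ n → 0ℚ < negPoch n
  negPoch-pos n = prodFrom1-pos n (λ k → +-mono-<-≤ (positive⁻¹ 1ℚ) (^-nonNeg (suc k) 0≤t))

  poch-antimono : ∀ {m n} → m ℕ.≤ n → poch n ≤ poch m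
  poch-antimono = prodFrom1-antimono (λ k → <⇒≤ (0<1-tˢ k)) (λ k → 1-tᵏ≤1 (suc k))

  poch-≤1 : ∀ n → poch n ≤ 1ℚ
  poch-≤1 n = poch-antimono (z≤n {n})

  evenPoch-≤1 : ∀ m → evenPoch m ≤ 1ℚ
  evenPoch-≤1 m = prodFrom1-≤1 m (λ j → <⇒≤ (0<1-t²ˢ j)) (λ j → 1-tᵏ≤1 (2 ℕ.* suc j))

  limit : ℕ → ℚ
  limit b = t ^ triangle b * inv (poch b)

  columnFactor : ℕ → ℚ
  columnFactor c = inv (evenPoch (c ℕ./ 2))

  invPoch : ℕ → ℚ
  invPoch c = inv (poch c)

  limit-pos : ∀ b → 0ℚ < limit b
  limit-pos b = *-pos (^-pos (triangle b) 0<t) (inv-pos (poch-pos b))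

  columnFactor-pos : ∀ c → 0ℚ < columnFactor c
  columnFactor-pos c = inv-pos (evenPoch-pos (c ℕ./ 2))

  1≤columnFactor : ∀ c → 1ℚ ≤ columnFactor c
  1≤columnFactor c = 1≤inv (evenPoch-pos (c ℕ./ 2)) (evenPoch-≤1 (c ℕ./ 2))

  invPoch-rec : ∀ c → (1ℚ - t ^ suc c) * invPoch (suc c) ≡ invPoch c
  invPoch-rec c = inv-prodFrom1-suc c _ (>0⇒≢0 (poch-pos c)) (>0⇒≢0 (0<1-tˢ c))

  invEvenPoch-rec : ∀ m → (1ℚ - t ^ (2 ℕ.* suc m)) * inv (evenPoch (suc m)) ≡ inv (evenPoch m)
  invEvenPoch-rec m = inv-prodFrom1-suc m _ (>0⇒≢0 (evenPoch-pos m)) (>0⇒≢0 (0<1-t²ˢ m))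

  limit-rec : ∀ b → (1ℚ - t ^ suc b) * limit (suc b) ≡ t ^ suc b * limit b
  limit-rec b = begin
    (1ℚ - s) * (t ^ triangle (suc b) * invPoch (suc b))
      ≡⟨ cong (λ k → (1ℚ - s) * (t ^ k * invPoch (suc b))) (triangle-suc b) ⟩
    (1ℚ - s) * (t ^ (triangle b ℕ.+ suc b) * invPoch (suc b))
      ≡⟨ cong (λ z → (1ℚ - s) * (z * invPoch (suc b))) (^-homo-* t (triangle b) (suc b)) ⟩
    (1ℚ - s) * (t ^ triangle b * s * invPoch (suc b))
      ≡⟨ solve 3 (λ s T i → (con 1ℚ :- s) :* (T :* s :* i) := s :* (T :* ((con 1ℚ :- s) :* i))) refl
           s (t ^ triangle b) (invPoch (suc b)) ⟩
    s * (t ^ triangle b * ((1ℚ - s) * invPoch (suc b)))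
      ≡⟨ cong (λ z → s * (t ^ triangle b * z)) (invPoch-rec b) ⟩
    s * limit b ∎
    where
    open ≡-Reasoning
    s = t ^ suc b

  ∂limit-suc : ∀ b → ∂ limit (suc b) ≡ t * twist limit b
  ∂limit-suc b = begin
    limit (suc b) - t ^ suc b * limit (suc b) ≡⟨ solve 2 (λ s x → x :- s :* x := (con 1ℚ :- s) :* x) refl (t ^ suc b) (limit (suc b)) ⟩
    (1ℚ - t ^ suc b) * limit (suc b)          ≡⟨ limit-rec b ⟩
    t * t ^ b * limit b                       ≡⟨ *-assoc t (t ^ b) (limit b) ⟩
    t * twist limit b                         ∎
    where open ≡-Reasoning

  ∂invPoch : ∀ c → ∂ invPoch c ≡ shift invPoch c
  ∂invPoch zero    = ∂-zero invPoch
  ∂invPoch (suc c) = trans (solve 2 (λ s x → x :- s :* x := (con 1ℚ :- s) :* x) refl (t ^ suc c) (invPoch (suc c)))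
                           (invPoch-rec c)

  columnFactor-even : ∀ m → columnFactor (m ℕ.+ m) ≡ inv (evenPoch m)
  columnFactor-even m = cong (inv ∘ evenPoch) ([m+m]/2≡m m)

  columnFactor-odd : ∀ m → columnFactor (suc (m ℕ.+ m)) ≡ inv (evenPoch m)
  columnFactor-odd m = cong (inv ∘ evenPoch) ([1+m+m]/2≡m m)

  invEvenPoch-rec-2+2m : ∀ m → (1ℚ - t ^ suc (suc (m ℕ.+ m))) * inv (evenPoch (suc m)) ≡ inv (evenPoch m)
  invEvenPoch-rec-2+2m m = subst (λ k → (1ℚ - t ^ k) * inv (evenPoch (suc m)) ≡ inv (evenPoch m))
    (trans (cong (suc m ℕ.+_) (ℕP.+-identityʳ (suc m))) (cong suc (ℕP.+-suc m m))) (invEvenPoch-rec m)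

  columnFactor-2+2m : ∀ m → columnFactor (suc (suc (m ℕ.+ m))) ≡ inv (evenPoch (suc m))
  columnFactor-2+2m m = trans (cong (columnFactor ∘ suc) (sym (ℕP.+-suc m m))) (columnFactor-even (suc m))

  columnFactor-3+2m : ∀ m → columnFactor (suc (suc (suc (m ℕ.+ m)))) ≡ inv (evenPoch (suc m))
  columnFactor-3+2m m = cong (inv ∘ evenPoch) (trans ([2+n]/2≡1+[n/2] (suc (m ℕ.+ m))) (cong suc ([1+m+m]/2≡m m)))

  ∂columnFactor-suc : ∀ c → ∂ columnFactor (suc c) ≡ (1ℚ - t) * columnFactor c + t * shift columnFactor c
  ∂columnFactor-suc zero = solve 1 (λ t → con 1ℚ :- (t :* con 1ℚ) :* con 1ℚ := (con 1ℚ :- t) :* con 1ℚ :+ t :* con 0ℚ) refl t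
  ∂columnFactor-suc (suc c) with even⊎odd c
  ... | inj₁ (m , refl) = begin
    ∂ columnFactor (suc (suc (m ℕ.+ m))) ≡⟨ cong (λ h → h - s * h) (columnFactor-2+2m m) ⟩
    Hₘ₊₁ - s * Hₘ₊₁                      ≡⟨ solve 2 (λ s h → h :- s :* h := (con 1ℚ :- s) :* h) refl s Hₘ₊₁ ⟩
    (1ℚ - s) * Hₘ₊₁                      ≡⟨ invEvenPoch-rec-2+2m m ⟩
    Hₘ                                   ≡⟨ solve 2 (λ t h → h := (con 1ℚ :- t) :* h :+ t :* h) refl t Hₘ ⟩
    (1ℚ - t) * Hₘ + t * Hₘ               ≡⟨ cong₂ (λ x y → (1ℚ - t) * x + t * y) (columnFactor-odd m) (columnFactor-even m) ⟨
    (1ℚ - t) * columnFactor (suc (m ℕ.+ m)) + t * columnFactor (m ℕ.+ m) ∎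
    where
    open ≡-Reasoning
    s = t ^ suc (suc (m ℕ.+ m))
    Hₘ = inv (evenPoch m)
    Hₘ₊₁ = inv (evenPoch (suc m))
  ... | inj₂ (m , refl) = begin
    ∂ columnFactor (suc (suc (suc (m ℕ.+ m)))) ≡⟨ cong (λ h → h - t * s * h) (columnFactor-3+2m m) ⟩
    Hₘ₊₁ - t * s * Hₘ₊₁                  ≡⟨ solve 3 (λ t s h → h :- t :* s :* h := (con 1ℚ :- t) :* h :+ t :* ((con 1ℚ :- s) :* h)) refl t s Hₘ₊₁ ⟩
    (1ℚ - t) * Hₘ₊₁ + t * ((1ℚ - s) * Hₘ₊₁) ≡⟨ cong (λ x → (1ℚ - t) * Hₘ₊₁ + t * x) (invEvenPoch-rec-2+2m m) ⟩
    (1ℚ - t) * Hₘ₊₁ + t * Hₘ             ≡⟨ cong₂ (λ x y → (1ℚ - t) * x + t * y) (columnFactor-2+2m m) (columnFactor-odd m) ⟨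
    (1ℚ - t) * columnFactor (suc (suc (m ℕ.+ m))) + t * columnFactor (suc (m ℕ.+ m)) ∎
    where
    open ≡-Reasoning
    s = t ^ suc (suc (m ℕ.+ m))
    Hₘ = inv (evenPoch m)
    Hₘ₊₁ = inv (evenPoch (suc m))

  ∂limit⋆ : ∀ a (G : ℕ → ℚ) → (∂ limit ⋆ G) a ≡ t * (twist limit ⋆ shift G) a
  ∂limit⋆ zero    G = trans (cong (_* G 0) (∂-zero limit))
    (solve 3 (λ t x y → con 0ℚ :* y := t :* (x :* con 0ℚ)) refl t (twist limit 0) (G 0))
  ∂limit⋆ (suc a) G = trans (∂⋆-suc a {limit} G ∂limit-suc) (cong (t *_) (sym (⋆-shift a (twist limit) G)))

  poch-recurrence : ∀ {u : ℕ → ℚ} (c : ℕ → ℚ) → (∀ a → (1ℚ - t ^ suc a) * u (suc a) ≡ c (suc a) * u a) →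
                    ∀ a → u a * poch a ≡ u 0 * prodFrom1 a c
  poch-recurrence c rec zero    = refl
  poch-recurrence {u} c rec (suc a) = begin
    u (suc a) * (poch a * (1ℚ - s))       ≡⟨ solve 3 (λ x q y → x :* (q :* y) := (y :* x) :* q) refl (u (suc a)) (poch a) (1ℚ - s) ⟩
    ((1ℚ - s) * u (suc a)) * poch a       ≡⟨ cong (_* poch a) (rec a) ⟩
    (c (suc a) * u a) * poch a            ≡⟨ solve 3 (λ c x q → (c :* x) :* q := c :* (x :* q)) refl (c (suc a)) (u a) (poch a) ⟩
    c (suc a) * (u a * poch a)            ≡⟨ cong (c (suc a) *_) (poch-recurrence c rec a) ⟩
    c (suc a) * (u 0 * prodFrom1 a c)     ≡⟨ solve 3 (λ c x P → c :* (x :* P) := x :* (P :* c)) refl (c (suc a)) (u 0) (prodFrom1 a c) ⟩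
    u 0 * prodFrom1 (suc a) c             ∎
    where
    open ≡-Reasoning
    s = t ^ suc a

  [limit⋆columnFactor]-rec : ∀ a → (1ℚ - t ^ suc a) * (limit ⋆ columnFactor) (suc a) ≡ 1ℚ * (limit ⋆ columnFactor) a
  [limit⋆columnFactor]-rec a = begin
    (1ℚ - t ^ suc a) * (limit ⋆ columnFactor) (suc a)
      ≡⟨ solve 2 (λ s x → (con 1ℚ :- s) :* x := x :- s :* x) refl (t ^ suc a) ((limit ⋆ columnFactor) (suc a)) ⟩
    ∂ (limit ⋆ columnFactor) (suc a)
      ≡⟨ ∂-⋆ (suc a) limit columnFactor ⟩
    (∂ limit ⋆ columnFactor) (suc a) + (twist limit ⋆ ∂ columnFactor) (suc a)
      ≡⟨ cong₂ _+_ (∂⋆-suc a {limit} columnFactor ∂limit-suc) (⋆-sucʳ a (twist limit) (∂ columnFactor)) ⟩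
    t * X + (twist limit (suc a) * ∂ columnFactor 0 + (twist limit ⋆ ∂ columnFactor ∘ suc) a)
      ≡⟨ cong₂ (λ u v → t * X + (twist limit (suc a) * u + v)) (∂-zero columnFactor)
           (trans (⋆-cong a (λ _ → refl) ∂columnFactor-suc) (⋆-+ʳ a (twist limit) _ _)) ⟩
    t * X + (twist limit (suc a) * 0ℚ + ((twist limit ⋆ (λ c → (1ℚ - t) * columnFactor c)) a + (twist limit ⋆ (λ c → t * shift columnFactor c)) a))
      ≡⟨ cong₂ (λ u v → t * X + (twist limit (suc a) * 0ℚ + (u + v))) (⋆-*ʳ a (1ℚ - t) (twist limit) columnFactor)
           (⋆-*ʳ a t (twist limit) (shift columnFactor)) ⟩
    t * X + (twist limit (suc a) * 0ℚ + ((1ℚ - t) * X + t * Y))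
      ≡⟨ solve 4 (λ t x y z → t :* x :+ (z :* con 0ℚ :+ ((con 1ℚ :- t) :* x :+ t :* y)) := x :+ t :* y) refl t X Y (twist limit (suc a)) ⟩
    X + t * Y
      ≡⟨ cong (X +_) (∂limit⋆ a columnFactor) ⟨
    X + (∂ limit ⋆ columnFactor) a
      ≡⟨ cong (X +_) (⋆--ˡ a limit (twist limit) columnFactor) ⟩
    X + ((limit ⋆ columnFactor) a - X)
      ≡⟨ solve 2 (λ x y → x :+ (y :- x) := con 1ℚ :* y) refl X ((limit ⋆ columnFactor) a) ⟩
    1ℚ * (limit ⋆ columnFactor) a ∎
    where
    open ≡-Reasoning
    X = (twist limit ⋆ columnFactor) a
    Y = (twist limit ⋆ shift columnFactor) a

  limit-eigen : ∀ a → t ^ triangle a * (limit ⋆ columnFactor) a ≡ limit a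
  limit-eigen a = cong (t ^ triangle a *_) (inv-unique (poch a) _ (begin
    (limit ⋆ columnFactor) a * poch a              ≡⟨ poch-recurrence {limit ⋆ columnFactor} (λ _ → 1ℚ) [limit⋆columnFactor]-rec a ⟩
    1ℚ * prodFrom1 a (λ _ → 1ℚ)              ≡⟨ cong (1ℚ *_) (prodFrom1-trailing-ones (λ _ _ → refl) (z≤n {a})) ⟩
    1ℚ                                       ∎))
    where open ≡-Reasoning

  [limit⋆invPoch]-rec : ∀ a → (1ℚ - t ^ suc a) * (limit ⋆ invPoch) (suc a) ≡ (1ℚ + t ^ suc a) * (limit ⋆ invPoch) a
  [limit⋆invPoch]-rec a = trans lhs (sym rhs)
    where
    open ≡-Reasoning
    K = limit ⋆ invPoch
    X = (twist limit ⋆ invPoch) a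
    Z = (twist limit ⋆ twist invPoch) a
    lhs : (1ℚ - t ^ suc a) * K (suc a) ≡ (1ℚ + t) * X
    lhs = begin
      (1ℚ - t ^ suc a) * K (suc a)
        ≡⟨ solve 2 (λ s x → (con 1ℚ :- s) :* x := x :- s :* x) refl (t ^ suc a) (K (suc a)) ⟩
      ∂ K (suc a)
        ≡⟨ ∂-⋆ (suc a) limit invPoch ⟩
      (∂ limit ⋆ invPoch) (suc a) + (twist limit ⋆ ∂ invPoch) (suc a)
        ≡⟨ cong₂ _+_ (∂⋆-suc a {limit} invPoch ∂limit-suc)
                     (trans (⋆-cong (suc a) {twist limit} (λ _ → refl) ∂invPoch) (⋆-shift a (twist limit) invPoch)) ⟩
      t * X + X
        ≡⟨ solve 2 (λ t x → t :* x :+ x := (con 1ℚ :+ t) :* x) refl t X ⟩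
      (1ℚ + t) * X ∎
    rhs : (1ℚ + t ^ suc a) * K a ≡ (1ℚ + t) * X
    rhs = begin
      (1ℚ + t * t ^ a) * K a
        ≡⟨ solve 3 (λ t tᵃ x → (con 1ℚ :+ t :* tᵃ) :* x := x :+ t :* (tᵃ :* x)) refl t (t ^ a) (K a) ⟩
      K a + t * (t ^ a * K a)
        ≡⟨ cong (λ z → K a + t * z) (⋆-geometric t a limit invPoch) ⟨
      K a + t * Z
        ≡⟨ cong (λ z → z + t * Z) (solve 2 (λ x k → k := x :+ (k :- x)) refl X (K a)) ⟩
      X + (K a - X) + t * Z
        ≡⟨ cong (λ z → X + z + t * Z) (⋆--ˡ a limit (twist limit) invPoch) ⟨
      X + (∂ limit ⋆ invPoch) a + t * Z
        ≡⟨ cong (λ z → X + z + t * Z) (∂limit⋆ a invPoch) ⟩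
      X + t * (twist limit ⋆ shift invPoch) a + t * Z
        ≡⟨ cong (λ z → X + t * z + t * Z) (trans (⋆-cong a {twist limit} (λ _ → refl) (sym ∘ ∂invPoch)) (⋆--ʳ a (twist limit) invPoch (twist invPoch))) ⟩
      X + t * (X - Z) + t * Z
        ≡⟨ solve 3 (λ t x z → x :+ t :* (x :- z) :+ t :* z := (con 1ℚ :+ t) :* x) refl t X Z ⟩
      (1ℚ + t) * X ∎

  q-binomial : ∀ r → (limit ⋆ invPoch) r * poch r ≡ negPoch r
  q-binomial r = trans (poch-recurrence {limit ⋆ invPoch} (λ k → 1ℚ + t ^ k) [limit⋆invPoch]-rec r) (*-identityˡ (negPoch r))

  lengthFactor : ℕ → ℕ → ℚ
  lengthFactor r a = inv (negPoch r) * (poch r * invPoch (r ∸ a))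

  lengthFactor-pos : ∀ r a → 0ℚ < lengthFactor r a
  lengthFactor-pos r a = *-pos (inv-pos (negPoch-pos r)) (*-pos (poch-pos r) (inv-pos (poch-pos (r ∸ a))))

  lengthFactor-limit-sum : ∀ r → sumUpTo r (λ a → lengthFactor r a * limit a) ≡ 1ℚ
  lengthFactor-limit-sum r = begin
    sumUpTo r (λ a → lengthFactor r a * limit a)
      ≡⟨ sumUpTo-cong r (λ a _ → solve 4 (λ d q i x → (d :* (q :* i)) :* x := (d :* q) :* (x :* i)) refl
                                          (inv (negPoch r)) (poch r) (invPoch (r ∸ a)) (limit a)) ⟩
    sumUpTo r (λ a → c * (limit a * invPoch (r ∸ a)))
      ≡⟨ sumUpTo-*ˡ r c (λ a → limit a * invPoch (r ∸ a)) ⟩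
    c * sumUpTo r (λ a → limit a * invPoch (r ∸ a))
      ≡⟨ cong (c *_) (⋆≡sumUpTo r limit invPoch) ⟨
    c * (limit ⋆ invPoch) r
      ≡⟨ solve 3 (λ a b k → (a :* b) :* k := a :* (k :* b)) refl (inv (negPoch r)) (poch r) ((limit ⋆ invPoch) r) ⟩
    inv (negPoch r) * ((limit ⋆ invPoch) r * poch r)
      ≡⟨ cong (inv (negPoch r) *_) (q-binomial r) ⟩
    inv (negPoch r) * negPoch r
      ≡⟨ inv-inverseˡ (>0⇒≢0 (negPoch-pos r)) ⟩
    1ℚ ∎
    where
    open ≡-Reasoning
    c = inv (negPoch r) * poch r

  truncated : ℕ → ℕ → ℚ
  truncated zero      = δ₀
  truncated (suc N) a = t ^ triangle a * (truncated N ⋆ columnFactor) a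

  limit-truncated-suc : ∀ N a → limit a - truncated (suc N) a ≡ t ^ triangle a * ((λ b → limit b - truncated N b) ⋆ columnFactor) a
  limit-truncated-suc N a = begin
    limit a - T * (truncated N ⋆ columnFactor) a
      ≡⟨ cong (λ z → z - T * (truncated N ⋆ columnFactor) a) (limit-eigen a) ⟨
    T * (limit ⋆ columnFactor) a - T * (truncated N ⋆ columnFactor) a
      ≡⟨ solve 3 (λ T x y → T :* x :- T :* y := T :* (x :- y)) refl T ((limit ⋆ columnFactor) a) ((truncated N ⋆ columnFactor) a) ⟩
    T * ((limit ⋆ columnFactor) a - (truncated N ⋆ columnFactor) a)
      ≡⟨ cong (T *_) (⋆--ˡ a limit (truncated N) columnFactor) ⟨
    T * ((λ b → limit b - truncated N b) ⋆ columnFactor) a ∎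
    where
    open ≡-Reasoning
    T = t ^ triangle a

  module Truncation (r : ℕ) where

    ρ : ℚ
    ρ = 1ℚ - poch r

    0≤ρ : 0ℚ ≤ ρ
    0≤ρ = p≤q⇒0≤q-p (poch-≤1 r)

    0≤ρᴺ : ∀ N → 0ℚ ≤ ρ ^ N
    0≤ρᴺ N = ^-nonNeg N 0≤ρ

    limit-gap : ∀ a → a ℕ.≤ r → limit a - t ^ triangle a * columnFactor a ≤ ρ * (limit a - δ₀ a)
    limit-gap zero    _   = ≤-reflexive (sym (*-zeroʳ ρ))
    limit-gap (suc a) a<r = 0≤q-p⇒p≤q (subst (0ℚ ≤_) rearrange (p≤q⇒0≤q-p (begin
      poch r * limit (suc a)       ≡⟨ solve 3 (λ q T i → q :* (T :* i) := T :* (q :* i)) refl (poch r) T (invPoch (suc a)) ⟩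
      T * (poch r * invPoch (suc a)) ≤⟨ *-monoˡ-≤-0≤ (^-nonNeg (triangle (suc a)) 0≤t) poch-ratio≤1 ⟩
      T * 1ℚ                       ≤⟨ *-monoˡ-≤-0≤ (^-nonNeg (triangle (suc a)) 0≤t) (1≤columnFactor (suc a)) ⟩
      T * columnFactor (suc a)           ∎)))
      where
      open ≤-Reasoning
      T = t ^ triangle (suc a)
      poch-ratio≤1 : poch r * invPoch (suc a) ≤ 1ℚ
      poch-ratio≤1 = subst (poch r * invPoch (suc a) ≤_) (inv-inverseʳ (>0⇒≢0 (poch-pos (suc a))))
        (*-monoʳ-≤-0≤ (<⇒≤ (inv-pos (poch-pos (suc a)))) (poch-antimono a<r))
      rearrange : T * columnFactor (suc a) - poch r * limit (suc a) ≡ ρ * (limit (suc a) - 0ℚ) - (limit (suc a) - T * columnFactor (suc a))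
      rearrange = solve 4 (λ P H q E → P :* H :- q :* E := (con 1ℚ :- q) :* (E :- con 0ℚ) :- (E :- P :* H)) refl
        T (columnFactor (suc a)) (poch r) (limit (suc a))

    truncation-error : ∀ N a → a ℕ.≤ r →
      0ℚ ≤ limit a - truncated N a × limit a - truncated N a ≤ ρ ^ N * (limit a - δ₀ a)
    truncation-error zero zero    _ = ≤-refl , ≤-refl
    truncation-error zero (suc a) _ = subst (0ℚ ≤_) (sym (+-identityʳ (limit (suc a)))) (<⇒≤ (limit-pos (suc a)))
                                    , ≤-reflexive (sym (*-identityˡ (limit (suc a) - 0ℚ)))
    truncation-error (suc N) a a≤r =
        subst (0ℚ ≤_) (sym (limit-truncated-suc N a))
          (*-nonNeg (^-nonNeg (triangle a) 0≤t) (⋆-nonNeg a (λ b b≤a → proj₁ (error b b≤a)) (<⇒≤ ∘ columnFactor-pos)))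
      , subst (_≤ ρ ^ suc N * (limit a - δ₀ a)) (sym (limit-truncated-suc N a)) (begin
      T * ((λ b → limit b - truncated N b) ⋆ columnFactor) a
        ≤⟨ *-monoˡ-≤-0≤ (^-nonNeg (triangle a) 0≤t) (⋆-monoˡ a (λ b b≤a → proj₂ (error b b≤a)) (<⇒≤ ∘ columnFactor-pos)) ⟩
      T * ((λ b → ρᴺ * (limit b - δ₀ b)) ⋆ columnFactor) a
        ≡⟨ cong (T *_) (trans (⋆-*ˡ a ρᴺ (λ b → limit b - δ₀ b) columnFactor)
                              (cong (ρᴺ *_) (trans (⋆--ˡ a limit δ₀ columnFactor) (cong (λ z → (limit ⋆ columnFactor) a - z) (⋆-identityˡ a columnFactor))))) ⟩
      T * (ρᴺ * ((limit ⋆ columnFactor) a - columnFactor a))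
        ≡⟨ solve 4 (λ T ρᴺ x y → T :* (ρᴺ :* (x :- y)) := ρᴺ :* (T :* x :- T :* y)) refl T ρᴺ ((limit ⋆ columnFactor) a) (columnFactor a) ⟩
      ρᴺ * (T * (limit ⋆ columnFactor) a - T * columnFactor a)
        ≡⟨ cong (λ z → ρᴺ * (z - T * columnFactor a)) (limit-eigen a) ⟩
      ρᴺ * (limit a - T * columnFactor a)
        ≤⟨ *-monoˡ-≤-0≤ (0≤ρᴺ N) (limit-gap a a≤r) ⟩
      ρᴺ * (ρ * (limit a - δ₀ a))
        ≡⟨ solve 3 (λ x y z → x :* (y :* z) := (y :* x) :* z) refl ρᴺ ρ (limit a - δ₀ a) ⟩
      ρ ^ suc N * (limit a - δ₀ a) ∎)
      where
      open ≤-Reasoning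
      T = t ^ triangle a
      ρᴺ = ρ ^ N
      error : ∀ b → b ℕ.≤ a → 0ℚ ≤ limit b - truncated N b × limit b - truncated N b ≤ ρᴺ * (limit b - δ₀ b)
      error b b≤a = truncation-error N b (ℕP.≤-trans b≤a a≤r)

    truncated≤limit : ∀ N a → a ℕ.≤ r → truncated N a ≤ limit a
    truncated≤limit N a a≤r = 0≤q-p⇒p≤q (proj₁ (truncation-error N a a≤r))

    [1-ρᴺ]limit≤truncated : ∀ N a → a ℕ.≤ r → (1ℚ - ρ ^ N) * limit a ≤ truncated N a
    [1-ρᴺ]limit≤truncated N a a≤r = 0≤q-p⇒p≤q (subst (0ℚ ≤_) rearrange (p≤q⇒0≤q-p (begin
      limit a - truncated N a    ≤⟨ proj₂ (truncation-error N a a≤r) ⟩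
      ρ ^ N * (limit a - δ₀ a)   ≤⟨ *-monoˡ-≤-0≤ (0≤ρᴺ N) (0≤q-p⇒p≤q (subst (0ℚ ≤_) (solve 2 (λ x y → y := x :- (x :- y)) refl (limit a) (δ₀ a)) (δ₀-nonNeg a))) ⟩
      ρ ^ N * limit a            ∎)))
      where
      open ≤-Reasoning
      rearrange : ρ ^ N * limit a - (limit a - truncated N a) ≡ truncated N a - (1ℚ - ρ ^ N) * limit a
      rearrange = solve 3 (λ r x y → r :* x :- (x :- y) := y :- (con 1ℚ :- r) :* x) refl (ρ ^ N) (limit a) (truncated N a)

    lengthFactor-truncated-sum≤1 : ∀ N → sumUpTo r (λ a → lengthFactor r a * truncated N a) ≤ 1ℚ
    lengthFactor-truncated-sum≤1 N = begin
      sumUpTo r (λ a → lengthFactor r a * truncated N a)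
        ≤⟨ sumUpTo-mono r (λ a a≤r → *-monoˡ-≤-0≤ (<⇒≤ (lengthFactor-pos r a)) (truncated≤limit N a a≤r)) ⟩
      sumUpTo r (λ a → lengthFactor r a * limit a)
        ≡⟨ lengthFactor-limit-sum r ⟩
      1ℚ ∎
      where open ≤-Reasoning

    1-ρᴺ≤lengthFactor-truncated-sum : ∀ N → 1ℚ - ρ ^ N ≤ sumUpTo r (λ a → lengthFactor r a * truncated N a)
    1-ρᴺ≤lengthFactor-truncated-sum N = begin
      1ℚ - ρ ^ N
        ≡⟨ *-identityʳ (1ℚ - ρ ^ N) ⟨
      (1ℚ - ρ ^ N) * 1ℚ
        ≡⟨ cong ((1ℚ - ρ ^ N) *_) (lengthFactor-limit-sum r) ⟨
      (1ℚ - ρ ^ N) * sumUpTo r (λ a → lengthFactor r a * limit a)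
        ≡⟨ sumUpTo-*ˡ r (1ℚ - ρ ^ N) _ ⟨
      sumUpTo r (λ a → (1ℚ - ρ ^ N) * (lengthFactor r a * limit a))
        ≤⟨ sumUpTo-mono r (λ a a≤r → termwise a a≤r) ⟩
      sumUpTo r (λ a → lengthFactor r a * truncated N a) ∎
      where
      open ≤-Reasoning
      termwise : ∀ a → a ℕ.≤ r → (1ℚ - ρ ^ N) * (lengthFactor r a * limit a) ≤ lengthFactor r a * truncated N a
      termwise a a≤r = subst (_≤ lengthFactor r a * truncated N a)
        (solve 3 (λ u c x → u :* (c :* x) := c :* (u :* x)) refl (lengthFactor r a) (1ℚ - ρ ^ N) (limit a))
        (*-monoˡ-≤-0≤ (<⇒≤ (lengthFactor-pos r a)) ([1-ρᴺ]limit≤truncated N a a≤r))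

-- Partitions by columns

PositiveParts : List ℕ → Set
PositiveParts = All (1 ℕ.≤_)

-- Adds a column of height length x + k in front of the Young diagram of x.
addColumn : ℕ → List ℕ → List ℕ
addColumn k x = map suc x ++ replicate k 1

length-addColumn : ∀ k x → length (addColumn k x) ≡ length x ℕ.+ k
length-addColumn k x = trans (ListP.length-++ (map suc x)) (cong₂ ℕ._+_ (ListP.length-map suc x) (ListP.length-replicate k))

addColumn-injective : ∀ k {x y} → addColumn k x ≡ addColumn k y → x ≡ y
addColumn-injective k {x} {y} eq =
  ListP.map-injective ℕP.suc-injective (ListP.++-cancelʳ (replicate k 1) (map suc x) (map suc y) eq)

replicate-positive : ∀ k → PositiveParts (replicate k 1)
replicate-positive zero    = []
replicate-positive (suc k) = ℕP.≤-refl ∷ replicate-positive k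

replicate-decreasing : ∀ k → Linked ℕ._≥_ (replicate k 1)
replicate-decreasing zero          = []
replicate-decreasing (suc zero)    = [-]
replicate-decreasing (suc (suc k)) = ℕP.≤-refl ∷ replicate-decreasing (suc k)

addColumn-decreasing : ∀ k x → Linked ℕ._≥_ x → PositiveParts x → Linked ℕ._≥_ (addColumn k x)
addColumn-decreasing k       []           _       _           = replicate-decreasing k
addColumn-decreasing zero    (_ ∷ [])     _       _           = [-]
addColumn-decreasing (suc k) (_ ∷ [])     _       _           = s≤s z≤n ∷ replicate-decreasing (suc k)
addColumn-decreasing k       (_ ∷ y ∷ xs) (r ∷ l) (_ ∷ ps)    = s≤s r ∷ addColumn-decreasing k (y ∷ xs) l ps

addColumn-partition : ∀ k x → IsPartition x → IsPartition (addColumn k x)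
addColumn-partition k x (dec , pos) =
    addColumn-decreasing k x dec pos
  , AllP.++⁺ (AllP.map⁺ (All.universal (λ _ → s≤s z≤n) x)) (replicate-positive k)

mult-++ : ∀ i xs ys → mult i (xs ++ ys) ≡ mult i xs ℕ.+ mult i ys
mult-++ i []       ys = refl
mult-++ i (x ∷ xs) ys with x ℕ.≟ i
... | yes _ = cong suc (mult-++ i xs ys)
... | no  _ = mult-++ i xs ys

mult-map-suc : ∀ i xs → mult (suc i) (map suc xs) ≡ mult i xs
mult-map-suc i []       = refl
mult-map-suc i (x ∷ xs) with suc x ℕ.≟ suc i | x ℕ.≟ i
... | yes _   | yes _   = cong suc (mult-map-suc i xs)
... | no  _   | no  _   = mult-map-suc i xs
... | yes 1+x≡1+i | no x≢i  = contradiction (ℕP.suc-injective 1+x≡1+i) x≢i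
... | no 1+x≢1+i  | yes x≡i = contradiction (cong suc x≡i) 1+x≢1+i

mult-zero : ∀ xs → PositiveParts xs → mult 0 xs ≡ 0
mult-zero []           _        = refl
mult-zero (suc _ ∷ xs) (_ ∷ ps) = mult-zero xs ps

mult-one-replicate : ∀ k → mult 1 (replicate k 1) ≡ k
mult-one-replicate zero    = refl
mult-one-replicate (suc k) = cong suc (mult-one-replicate k)

mult-2+-replicate : ∀ i k → mult (suc (suc i)) (replicate k 1) ≡ 0
mult-2+-replicate i zero    = refl
mult-2+-replicate i (suc k) = mult-2+-replicate i k

mult-one-addColumn : ∀ k x → PositiveParts x → mult 1 (addColumn k x) ≡ k
mult-one-addColumn k x pos = trans (mult-++ 1 (map suc x) (replicate k 1))
  (cong₂ ℕ._+_ (trans (mult-map-suc 0 x) (mult-zero x pos)) (mult-one-replicate k))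

mult-2+-addColumn : ∀ i k x → mult (suc (suc i)) (addColumn k x) ≡ mult (suc i) x
mult-2+-addColumn i k x = trans (mult-++ (suc (suc i)) (map suc x) (replicate k 1))
  (trans (cong₂ ℕ._+_ (mult-map-suc (suc i) x) (mult-2+-replicate i k)) (ℕP.+-identityʳ _))

∈⇒≤size : ∀ {y} xs → y ∈ xs → y ℕ.≤ size xs
∈⇒≤size (x ∷ xs) (here refl) = ℕP.m≤m+n x (size xs)
∈⇒≤size (x ∷ xs) (there y∈xs) = ℕP.≤-trans (∈⇒≤size xs y∈xs) (ℕP.m≤n+m (size xs) x)

mult-size< : ∀ i xs → size xs ℕ.< i → mult i xs ≡ 0
mult-size< i xs size<i = go xs (λ y∈xs → ℕP.≤-<-trans (∈⇒≤size xs y∈xs) size<i)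
  where
  go : ∀ ys → (∀ {y} → y ∈ ys → y ℕ.< i) → mult i ys ≡ 0
  go []       _    = refl
  go (y ∷ ys) ys<i with y ℕ.≟ i
  ... | yes refl = contradiction (ys<i (here refl)) (ℕP.<-irrefl refl)
  ... | no  _    = go ys (ys<i ∘ there)

size-++ : ∀ xs ys → size (xs ++ ys) ≡ size xs ℕ.+ size ys
size-++ []       ys = refl
size-++ (x ∷ xs) ys = trans (cong (x ℕ.+_) (size-++ xs ys)) (sym (ℕP.+-assoc x _ _))

size≤size-map-suc : ∀ xs → size xs ℕ.≤ size (map suc xs)
size≤size-map-suc []       = z≤n
size≤size-map-suc (x ∷ xs) = ℕP.+-mono-≤ (ℕP.n≤1+n x) (size≤size-map-suc xs)

size≤size-addColumn : ∀ k x → size x ℕ.≤ size (addColumn k x)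
size≤size-addColumn k x = ℕP.≤-trans (size≤size-map-suc x)
  (ℕP.≤-trans (ℕP.m≤m+n _ _) (ℕP.≤-reflexive (sym (size-++ (map suc x) (replicate k 1)))))

PartitionOfLength : ℕ → List ℕ → Set
PartitionOfLength n μ = IsPartition μ × length μ ≡ n

addColumn-ofLength : ∀ k {n x} → PartitionOfLength n x → PartitionOfLength (n ℕ.+ k) (addColumn k x)
addColumn-ofLength k {x = x} (isPartition , refl) = addColumn-partition k x isPartition , length-addColumn k x

castLength : ∀ {m n L} → m ≡ n → All (PartitionOfLength m) L → All (PartitionOfLength n) L
castLength refl ofLength = ofLength

-- The partitions addColumn k x with x in F b and b + k = a.
withColumn : (ℕ → List (List ℕ)) → ℕ → List (List ℕ)
withColumn F zero    = map (addColumn 0) (F 0)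
withColumn F (suc a) = map (addColumn (suc a)) (F 0) ++ withColumn (F ∘ suc) a

withColumn-ofLength : ∀ a d F → (∀ b → All (PartitionOfLength (d ℕ.+ b)) (F b)) →
                      All (PartitionOfLength (d ℕ.+ a)) (withColumn F a)
withColumn-ofLength zero d F ofLength =
  castLength (ℕP.+-identityʳ _) (AllP.map⁺ (All.map (addColumn-ofLength 0) (ofLength 0)))
withColumn-ofLength (suc a) d F ofLength = AllP.++⁺
  (castLength (cong (ℕ._+ suc a) (ℕP.+-identityʳ d)) (AllP.map⁺ (All.map (addColumn-ofLength (suc a)) (ofLength 0))))
  (castLength (sym (ℕP.+-suc d a))
    (withColumn-ofLength a (suc d) (F ∘ suc) (λ b → castLength (ℕP.+-suc d b) (ofLength (suc b)))))

withColumn-mult-one : ∀ a F → (∀ b → All IsPartition (F b)) → All (λ μ → mult 1 μ ℕ.≤ a) (withColumn F a)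
withColumn-mult-one zero    F partitions =
  AllP.map⁺ (All.map (λ {x} (_ , pos) → ℕP.≤-reflexive (mult-one-addColumn 0 x pos)) (partitions 0))
withColumn-mult-one (suc a) F partitions = AllP.++⁺
  (AllP.map⁺ (All.map (λ {x} (_ , pos) → ℕP.≤-reflexive (mult-one-addColumn (suc a) x pos)) (partitions 0)))
  (All.map ℕP.m≤n⇒m≤1+n (withColumn-mult-one a (F ∘ suc) (partitions ∘ suc)))

-- The blocks of withColumn F (suc a) are told apart by the number of parts equal to 1.
withColumn-unique : ∀ a F → (∀ b → Unique (F b)) → (∀ b → All IsPartition (F b)) → Unique (withColumn F a)
withColumn-unique zero    F unique _ = UniqueP.map⁺ (addColumn-injective 0) (unique 0)
withColumn-unique (suc a) F unique partitions =
  UniqueP.++⁺ (UniqueP.map⁺ (addColumn-injective (suc a)) (unique 0))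
              (withColumn-unique a (F ∘ suc) (unique ∘ suc) (partitions ∘ suc)) disjoint
  where
  disjoint : ∀ {μ} → ¬ (μ ∈ map (addColumn (suc a)) (F 0) × μ ∈ withColumn (F ∘ suc) a)
  disjoint (μ∈first , μ∈rest) with ∈-map⁻ (addColumn (suc a)) μ∈first
  ... | x , x∈F₀ , refl = ℕP.<-irrefl (mult-one-addColumn (suc a) x (proj₂ (All.lookup (partitions 0) x∈F₀)))
                            (s≤s (All.lookup (withColumn-mult-one a (F ∘ suc) (partitions ∘ suc)) μ∈rest))

-- The partitions of length a with all parts ≤ N.
boundedPartitions : ℕ → ℕ → List (List ℕ)
boundedPartitions zero    zero    = [] ∷ []
boundedPartitions zero    (suc _) = []
boundedPartitions (suc N) a       = withColumn (boundedPartitions N) a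

boundedPartitions-ofLength : ∀ N a → All (PartitionOfLength a) (boundedPartitions N a)
boundedPartitions-ofLength zero    zero    = (([] , []) , refl) ∷ []
boundedPartitions-ofLength zero    (suc a) = []
boundedPartitions-ofLength (suc N) a       = withColumn-ofLength a 0 (boundedPartitions N) (boundedPartitions-ofLength N)

boundedPartitions-partition : ∀ N a → All IsPartition (boundedPartitions N a)
boundedPartitions-partition N a = All.map proj₁ (boundedPartitions-ofLength N a)

boundedPartitions-unique : ∀ N a → Unique (boundedPartitions N a)
boundedPartitions-unique zero    zero    = [] AllPairs.∷ AllPairs.[]
boundedPartitions-unique zero    (suc a) = AllPairs.[]
boundedPartitions-unique (suc N) a       =
  withColumn-unique a (boundedPartitions N) (boundedPartitions-unique N) (boundedPartitions-partition N)

column-decomposition : ∀ μ → IsPartition μ → ∃[ x ] ∃[ k ] μ ≡ addColumn k x × IsPartition x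
column-decomposition []      _ = [] , 0 , refl , ([] , [])
column-decomposition (m ∷ μ) (dec , 1≤m ∷ pos) with column-decomposition μ (Linked.tail dec , pos)
column-decomposition (suc zero ∷ _) _ | [] , k , refl , _ = [] , suc k , refl , ([] , [])
column-decomposition (suc zero ∷ _) (1≥y+1 ∷ _ , _) | (y ∷ _) , _ , refl , (_ , 1≤y ∷ _) =
  contradiction (ℕP.≤-pred 1≥y+1) (ℕP.<⇒≱ 1≤y)
column-decomposition (suc (suc m) ∷ _) _ | [] , k , refl , (_ , pos) =
  (suc m ∷ []) , k , refl , ([-] , s≤s z≤n ∷ pos)
column-decomposition (suc (suc m) ∷ _) (m+2≥y+1 ∷ _ , _) | (y ∷ ys) , k , refl , (dec , pos) =
  (suc m ∷ y ∷ ys) , k , refl , (ℕP.≤-pred m+2≥y+1 ∷ dec , s≤s z≤n ∷ pos)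

addColumn∈withColumn : ∀ F b k x → x ∈ F b → addColumn k x ∈ withColumn F (b ℕ.+ k)
addColumn∈withColumn F zero    zero    x x∈F = ∈-map⁺ (addColumn 0) x∈F
addColumn∈withColumn F zero    (suc k) x x∈F = ∈-++⁺ˡ (∈-map⁺ (addColumn (suc k)) x∈F)
addColumn∈withColumn F (suc b) k       x x∈F =
  ∈-++⁺ʳ (map (addColumn (suc (b ℕ.+ k))) (F 0)) (addColumn∈withColumn (F ∘ suc) b k x x∈F)

boundedPartitions-complete : ∀ N μ → IsPartition μ → All (ℕ._≤ N) μ → μ ∈ boundedPartitions N (length μ)
boundedPartitions-complete zero    []      _                _         = here refl
boundedPartitions-complete zero    (m ∷ μ) (_ , 1≤m ∷ _)    (m≤0 ∷ _) = contradiction (ℕP.≤-trans 1≤m m≤0) λ ()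
boundedPartitions-complete (suc N) μ       isPartition      μ≤N+1 with column-decomposition μ isPartition
... | x , k , refl , x-partition = subst (λ n → addColumn k x ∈ boundedPartitions (suc N) n) (sym (length-addColumn k x))
  (addColumn∈withColumn (boundedPartitions N) (length x) k x
    (boundedPartitions-complete N x x-partition (All.map ℕP.≤-pred (AllP.map⁻ (AllP.++⁻ˡ (map suc x) μ≤N+1)))))

boundedPartitionsUpTo : ℕ → ℕ → List (List ℕ)
boundedPartitionsUpTo N zero    = boundedPartitions N 0
boundedPartitionsUpTo N (suc r) = boundedPartitionsUpTo N r ++ boundedPartitions N (suc r)

boundedPartitionsUpTo-complete : ∀ N r {a μ} → μ ∈ boundedPartitions N a → a ℕ.≤ r → μ ∈ boundedPartitionsUpTo N r
boundedPartitionsUpTo-complete N zero    μ∈ z≤n = μ∈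
boundedPartitionsUpTo-complete N (suc r) {a} μ∈ a≤1+r with a ℕ.≟ suc r
... | yes refl = ∈-++⁺ʳ (boundedPartitionsUpTo N r) μ∈
... | no  a≢1+r = ∈-++⁺ˡ (boundedPartitionsUpTo-complete N r μ∈ (ℕP.≤-pred (ℕP.≤∧≢⇒< a≤1+r a≢1+r)))

boundedPartitionsUpTo-covers : ∀ r {L} → All (PartitionAtMost r) L → ∀ {μ} → μ ∈ L → μ ∈ boundedPartitionsUpTo (size (map size L)) r
boundedPartitionsUpTo-covers r {L} atMost {μ} μ∈L with All.lookup atMost μ∈L
... | isPartition , length≤r = boundedPartitionsUpTo-complete (size (map size L)) r
  (boundedPartitions-complete (size (map size L)) μ isPartition
    (All.tabulate (λ y∈μ → ℕP.≤-trans (∈⇒≤size μ y∈μ) (∈⇒≤size (map size L) (∈-map⁺ size μ∈L)))))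
  length≤r

boundedPartitionsUpTo-atMost : ∀ N r → All (PartitionAtMost r) (boundedPartitionsUpTo N r)
boundedPartitionsUpTo-atMost N zero    =
  All.map (λ (isPartition , length≡0) → isPartition , ℕP.≤-reflexive length≡0) (boundedPartitions-ofLength N 0)
boundedPartitionsUpTo-atMost N (suc r) = AllP.++⁺
  (All.map (λ (isPartition , length≤r) → isPartition , ℕP.m≤n⇒m≤1+n length≤r) (boundedPartitionsUpTo-atMost N r))
  (All.map (λ (isPartition , length≡) → isPartition , ℕP.≤-reflexive length≡) (boundedPartitions-ofLength N (suc r)))

boundedPartitionsUpTo-unique : ∀ N r → Unique (boundedPartitionsUpTo N r)
boundedPartitionsUpTo-unique N zero    = boundedPartitions-unique N 0
boundedPartitionsUpTo-unique N (suc r) =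
  UniqueP.++⁺ (boundedPartitionsUpTo-unique N r) (boundedPartitions-unique N (suc r)) disjoint
  where
  disjoint : ∀ {μ} → ¬ (μ ∈ boundedPartitionsUpTo N r × μ ∈ boundedPartitions N (suc r))
  disjoint (μ∈first , μ∈last) = ℕP.<-irrefl (proj₂ (All.lookup (boundedPartitions-ofLength N (suc r)) μ∈last))
    (s≤s (proj₂ (All.lookup (boundedPartitionsUpTo-atMost N r) μ∈first)))


-- The exponent n(λ) + |λ|

nAux-suc : ∀ k xs → nAux (suc k) xs ≡ nAux k xs ℕ.+ size xs
nAux-suc k []       = refl
nAux-suc k (x ∷ xs) rewrite nAux-suc (suc k) xs =
  solveℕ 4 (λ x kx n s → (x ⊕ kx) ⊕ (n ⊕ s) ≐ (kx ⊕ n) ⊕ (x ⊕ s)) refl x (k ℕ.* x) (nAux (suc k) xs) (size xs)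

nAux-++ : ∀ k xs ys → nAux k (xs ++ ys) ≡ nAux k xs ℕ.+ nAux (k ℕ.+ length xs) ys
nAux-++ k []       ys = cong (λ j → nAux j ys) (sym (ℕP.+-identityʳ k))
nAux-++ k (x ∷ xs) ys rewrite nAux-++ (suc k) xs ys | ℕP.+-suc k (length xs) = sym (ℕP.+-assoc (k ℕ.* x) _ _)

nAux-map-suc : ∀ k xs → nAux k (map suc xs) ≡ nAux k xs ℕ.+ consecutiveSum k (length xs)
nAux-map-suc k []       = refl
nAux-map-suc k (x ∷ xs) rewrite nAux-map-suc (suc k) xs | ℕP.*-suc k x =
  solveℕ 4 (λ k kx n c → (k ⊕ kx) ⊕ (n ⊕ c) ≐ (kx ⊕ n) ⊕ (k ⊕ c)) refl
    k (k ℕ.* x) (nAux (suc k) xs) (consecutiveSum (suc k) (length xs))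

nAux-replicate-one : ∀ k m → nAux k (replicate m 1) ≡ consecutiveSum k m
nAux-replicate-one k zero    = refl
nAux-replicate-one k (suc m) = cong₂ ℕ._+_ (ℕP.*-identityʳ k) (nAux-replicate-one (suc k) m)

nAux-one-addColumn : ∀ k x → nAux 1 (addColumn k x) ≡ triangle (length x ℕ.+ k) ℕ.+ nAux 1 x
nAux-one-addColumn k x = begin
  nAux 1 (map suc x ++ replicate k 1)
    ≡⟨ nAux-++ 1 (map suc x) (replicate k 1) ⟩
  nAux 1 (map suc x) ℕ.+ nAux (suc (length (map suc x))) (replicate k 1)
    ≡⟨ cong₂ ℕ._+_ (nAux-map-suc 1 x)
         (trans (cong (λ l → nAux (suc l) (replicate k 1)) (ListP.length-map suc x)) (nAux-replicate-one (suc (length x)) k)) ⟩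
  nAux 1 x ℕ.+ triangle (length x) ℕ.+ consecutiveSum (suc (length x)) k
    ≡⟨ solveℕ 3 (λ n a b → (n ⊕ a) ⊕ b ≐ (a ⊕ b) ⊕ n) refl (nAux 1 x) (triangle (length x)) (consecutiveSum (suc (length x)) k) ⟩
  triangle (length x) ℕ.+ consecutiveSum (suc (length x)) k ℕ.+ nAux 1 x
    ≡⟨ cong (ℕ._+ nAux 1 x) (consecutiveSum-+ 1 (length x) k) ⟨
  triangle (length x ℕ.+ k) ℕ.+ nAux 1 x ∎
  where open ≡-Reasoning

module PrimeWeights (p : ℕ) (1<p : 1 ℕ.< p) where

  0<p : 0ℚ < ofℕ p
  0<p = ofℕ-pos (ℕP.<-trans (s≤s z≤n) 1<p)

  t : ℚ
  t = inv (ofℕ p)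

  0<t : 0ℚ < t
  0<t = inv-pos 0<p

  t<1 : t < 1ℚ
  t<1 = subst₂ _<_ (*-identityʳ t) (inv-inverseˡ (>0⇒≢0 0<p)) (*-monoʳ-<-pos t {{positive 0<t}} (1<ofℕ 1<p))

  open Series t 0<t t<1 public

  invPow≡t^ : ∀ k → invPow p k ≡ t ^ k
  invPow≡t^ k = trans (cong inv (ofℕ-^ p k)) (inv-^ k 0<p)

  oneMinusProd≡poch : ∀ n → oneMinusProd p n ≡ poch n
  oneMinusProd≡poch n = prodFrom1-cong n (λ k → cong (λ x → 1ℚ - x) (invPow≡t^ (suc k)))

  negPoch-invPow : ∀ n → prodFrom1 n (λ k → 1ℚ + invPow p k) ≡ negPoch n
  negPoch-invPow n = prodFrom1-cong n (λ k → cong (1ℚ +_) (invPow≡t^ (suc k)))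

  multiplicityFactor : ℕ → ℚ
  multiplicityFactor m = prodFrom1 (m ℕ./ 2) (λ j → 1ℚ - invPow p (2 ℕ.* j))

  multiplicityFactor≡evenPoch : ∀ m → multiplicityFactor m ≡ evenPoch (m ℕ./ 2)
  multiplicityFactor≡evenPoch m = prodFrom1-cong (m ℕ./ 2) (λ j → cong (λ x → 1ℚ - x) (invPow≡t^ (2 ℕ.* suc j)))

  multiplicityFactor-pos : ∀ m → 0ℚ < multiplicityFactor m
  multiplicityFactor-pos m = subst (0ℚ <_) (sym (multiplicityFactor≡evenPoch m)) (evenPoch-pos (m ℕ./ 2))

  multProd-pos : ∀ μ → 0ℚ < multProd p μ
  multProd-pos μ = prodFrom1-pos (size μ) (λ i → multiplicityFactor-pos (mult (suc i) μ))

  multProd-extend : ∀ μ {M} → size μ ℕ.≤ M → multProd p μ ≡ prodFrom1 M (λ i → multiplicityFactor (mult i μ))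
  multProd-extend μ size≤M = sym (prodFrom1-trailing-ones (λ i size<i → cong multiplicityFactor (mult-size< i μ size<i)) size≤M)

  multProd-addColumn : ∀ k x → PositiveParts x → multProd p (addColumn k x) ≡ multiplicityFactor k * multProd p x
  multProd-addColumn k x pos = begin
    multProd p μ
      ≡⟨ multProd-extend μ (ℕP.n≤1+n M) ⟩
    prodFrom1 (suc M) (λ i → multiplicityFactor (mult i μ))
      ≡⟨ prodFrom1-suc M (λ i → multiplicityFactor (mult i μ)) ⟩
    multiplicityFactor (mult 1 μ) * prodFrom1 M (λ i → multiplicityFactor (mult (suc i) μ))
      ≡⟨ cong₂ _*_ (cong multiplicityFactor (mult-one-addColumn k x pos))
                   (prodFrom1-cong M (λ i → cong multiplicityFactor (mult-2+-addColumn i k x))) ⟩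
    multiplicityFactor k * prodFrom1 M (λ i → multiplicityFactor (mult i x))
      ≡⟨ cong (multiplicityFactor k *_) (multProd-extend x (size≤size-addColumn k x)) ⟨
    multiplicityFactor k * multProd p x ∎
    where
    open ≡-Reasoning
    μ = addColumn k x
    M = size μ

  shapeWeight : List ℕ → ℚ
  shapeWeight μ = inv (ofℕ (p ℕ.^ (nfun μ ℕ.+ size μ)) * multProd p μ)

  0<p^ : ∀ n → 0ℚ < ofℕ (p ℕ.^ n)
  0<p^ n = subst (0ℚ <_) (sym (ofℕ-^ p n)) (^-pos n 0<p)

  shapeWeight-pos : ∀ μ → 0ℚ < shapeWeight μ
  shapeWeight-pos μ = inv-pos (*-pos (0<p^ (nfun μ ℕ.+ size μ)) (multProd-pos μ))

  shapeWeight-addColumn : ∀ k x → PositiveParts x →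
                          shapeWeight (addColumn k x) ≡ t ^ triangle (length x ℕ.+ k) * columnFactor k * shapeWeight x
  shapeWeight-addColumn k x pos = begin
    inv (ofℕ (p ℕ.^ (nfun μ ℕ.+ size μ)) * multProd p μ)
      ≡⟨ cong₂ (λ e m → inv (ofℕ (p ℕ.^ e) * m)) exponent (multProd-addColumn k x pos) ⟩
    inv (ofℕ (p ℕ.^ (T ℕ.+ E)) * (multiplicityFactor k * multProd p x))
      ≡⟨ cong (λ u → inv (u * (multiplicityFactor k * multProd p x)))
              (trans (cong ofℕ (ℕP.^-distribˡ-+-* p T E)) (ofℕ-* (p ℕ.^ T) (p ℕ.^ E))) ⟩
    inv ((pᵀ * pᴱ) * (multiplicityFactor k * multProd p x))
      ≡⟨ cong inv (solve 4 (λ a b g m → (a :* b) :* (g :* m) := (a :* g) :* (b :* m)) refl pᵀ pᴱ (multiplicityFactor k) (multProd p x)) ⟩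
    inv ((pᵀ * multiplicityFactor k) * (pᴱ * multProd p x))
      ≡⟨ inv-distrib-* (>0⇒≢0 (*-pos (0<p^ T) (multiplicityFactor-pos k))) (>0⇒≢0 (*-pos (0<p^ E) (multProd-pos x))) ⟩
    inv (pᵀ * multiplicityFactor k) * shapeWeight x
      ≡⟨ cong (_* shapeWeight x) (inv-distrib-* (>0⇒≢0 (0<p^ T)) (>0⇒≢0 (multiplicityFactor-pos k))) ⟩
    inv pᵀ * inv (multiplicityFactor k) * shapeWeight x
      ≡⟨ cong₂ (λ u v → u * v * shapeWeight x) (invPow≡t^ T) (cong inv (multiplicityFactor≡evenPoch k)) ⟩
    t ^ T * columnFactor k * shapeWeight x ∎
    where
    open ≡-Reasoning
    μ = addColumn k x
    T = triangle (length x ℕ.+ k)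
    E = nfun x ℕ.+ size x
    pᵀ = ofℕ (p ℕ.^ T)
    pᴱ = ofℕ (p ℕ.^ E)
    exponent : nfun μ ℕ.+ size μ ≡ T ℕ.+ E
    exponent = trans (sym (nAux-suc 0 μ)) (trans (nAux-one-addColumn k x) (cong (T ℕ.+_) (nAux-suc 0 x)))

  weight≡lengthFactor*shapeWeight : ∀ r μ → weight p r μ ≡ lengthFactor r (length μ) * shapeWeight μ
  weight≡lengthFactor*shapeWeight r μ = begin
    (inv (prodFrom1 r (λ k → 1ℚ + invPow p k)) * shapeWeight μ) * (oneMinusProd p r * inv (oneMinusProd p (r ∸ length μ)))
      ≡⟨ cong₂ (λ u v → (inv u * shapeWeight μ) * v) (negPoch-invPow r)
               (cong₂ (λ u v → u * inv v) (oneMinusProd≡poch r) (oneMinusProd≡poch (r ∸ length μ))) ⟩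
    (inv (negPoch r) * shapeWeight μ) * (poch r * invPoch (r ∸ length μ))
      ≡⟨ solve 3 (λ a b c → (a :* b) :* c := (a :* c) :* b) refl (inv (negPoch r)) (shapeWeight μ) (poch r * invPoch (r ∸ length μ)) ⟩
    lengthFactor r (length μ) * shapeWeight μ ∎
    where open ≡-Reasoning

  weight-pos : ∀ r μ → 0ℚ < weight p r μ
  weight-pos r μ = subst (0ℚ <_) (sym (weight≡lengthFactor*shapeWeight r μ))
    (*-pos (lengthFactor-pos r (length μ)) (shapeWeight-pos μ))

  addColumn-shapeWeight-sum : ∀ k {n} xs → All (PartitionOfLength n) xs →
    sumℚ (map shapeWeight (map (addColumn k) xs)) ≡ t ^ triangle (n ℕ.+ k) * columnFactor k * sumℚ (map shapeWeight xs)
  addColumn-shapeWeight-sum k {n} xs ofLength = trans (cong sumℚ (sym (ListP.map-∘ xs)))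
    (sumℚ-map-scale (shapeWeight ∘ addColumn k) shapeWeight (t ^ triangle (n ℕ.+ k) * columnFactor k)
      (All.map (λ {x} ((_ , pos) , length≡n) → trans (shapeWeight-addColumn k x pos)
                    (cong (λ l → t ^ triangle (l ℕ.+ k) * columnFactor k * shapeWeight x) length≡n)) ofLength))

  withColumn-shapeWeight-sum : ∀ a d F → (∀ b → All (PartitionOfLength (d ℕ.+ b)) (F b)) →
    sumℚ (map shapeWeight (withColumn F a)) ≡ t ^ triangle (d ℕ.+ a) * ((λ b → sumℚ (map shapeWeight (F b))) ⋆ columnFactor) a
  withColumn-shapeWeight-sum zero d F ofLength = begin
    sumℚ (map shapeWeight (map (addColumn 0) (F 0)))
      ≡⟨ addColumn-shapeWeight-sum 0 (F 0) (ofLength 0) ⟩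
    t ^ triangle (d ℕ.+ 0 ℕ.+ 0) * columnFactor 0 * S 0
      ≡⟨ cong (λ n → t ^ triangle n * columnFactor 0 * S 0) (ℕP.+-identityʳ (d ℕ.+ 0)) ⟩
    t ^ triangle (d ℕ.+ 0) * columnFactor 0 * S 0
      ≡⟨ solve 3 (λ a b c → a :* b :* c := a :* (c :* b)) refl (t ^ triangle (d ℕ.+ 0)) (columnFactor 0) (S 0) ⟩
    t ^ triangle (d ℕ.+ 0) * (S ⋆ columnFactor) 0 ∎
    where
    open ≡-Reasoning
    S = λ b → sumℚ (map shapeWeight (F b))
  withColumn-shapeWeight-sum (suc a) d F ofLength = begin
    sumℚ (map shapeWeight (map (addColumn (suc a)) (F 0) ++ withColumn (F ∘ suc) a))
      ≡⟨ sumℚ-map-++ shapeWeight (map (addColumn (suc a)) (F 0)) (withColumn (F ∘ suc) a) ⟩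
    sumℚ (map shapeWeight (map (addColumn (suc a)) (F 0))) + sumℚ (map shapeWeight (withColumn (F ∘ suc) a))
      ≡⟨ cong₂ _+_ (addColumn-shapeWeight-sum (suc a) (F 0) (ofLength 0))
           (withColumn-shapeWeight-sum a (suc d) (F ∘ suc) (λ b → castLength (ℕP.+-suc d b) (ofLength (suc b)))) ⟩
    t ^ triangle (d ℕ.+ 0 ℕ.+ suc a) * columnFactor (suc a) * S 0 + t ^ triangle (suc d ℕ.+ a) * (S ∘ suc ⋆ columnFactor) a
      ≡⟨ cong₂ (λ m n → t ^ triangle m * columnFactor (suc a) * S 0 + t ^ triangle n * (S ∘ suc ⋆ columnFactor) a)
           (cong (ℕ._+ suc a) (ℕP.+-identityʳ d)) (sym (ℕP.+-suc d a)) ⟩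
    T * columnFactor (suc a) * S 0 + T * (S ∘ suc ⋆ columnFactor) a
      ≡⟨ solve 4 (λ T x y z → T :* x :* y :+ T :* z := T :* (y :* x :+ z)) refl T (columnFactor (suc a)) (S 0) ((S ∘ suc ⋆ columnFactor) a) ⟩
    T * (S ⋆ columnFactor) (suc a) ∎
    where
    open ≡-Reasoning
    S = λ b → sumℚ (map shapeWeight (F b))
    T = t ^ triangle (d ℕ.+ suc a)

  boundedPartitions-shapeWeight-sum : ∀ N a → sumℚ (map shapeWeight (boundedPartitions N a)) ≡ truncated N a
  boundedPartitions-shapeWeight-sum zero    zero    = refl
  boundedPartitions-shapeWeight-sum zero    (suc a) = refl
  boundedPartitions-shapeWeight-sum (suc N) a       =
    trans (withColumn-shapeWeight-sum a 0 (boundedPartitions N) (boundedPartitions-ofLength N))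
          (cong (t ^ triangle a *_) (⋆-cong a (boundedPartitions-shapeWeight-sum N) (λ _ → refl)))

  boundedPartitions-weight-sum : ∀ r N a → sumℚ (map (weight p r) (boundedPartitions N a)) ≡ lengthFactor r a * truncated N a
  boundedPartitions-weight-sum r N a = trans
    (sumℚ-map-scale (weight p r) shapeWeight (lengthFactor r a)
      (All.map (λ {μ} (_ , length≡a) → trans (weight≡lengthFactor*shapeWeight r μ)
                                            (cong (λ l → lengthFactor r l * shapeWeight μ) length≡a))
               (boundedPartitions-ofLength N a)))
    (cong (lengthFactor r a *_) (boundedPartitions-shapeWeight-sum N a))

  boundedPartitionsUpTo-weight-sum : ∀ r N m →
    sumℚ (map (weight p r) (boundedPartitionsUpTo N m)) ≡ sumUpTo m (λ a → lengthFactor r a * truncated N a)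
  boundedPartitionsUpTo-weight-sum r N zero    = boundedPartitions-weight-sum r N 0
  boundedPartitionsUpTo-weight-sum r N (suc m) =
    trans (sumℚ-map-++ (weight p r) (boundedPartitionsUpTo N m) (boundedPartitions N (suc m)))
          (cong₂ _+_ (boundedPartitionsUpTo-weight-sum r N m) (boundedPartitions-weight-sum r N (suc m)))

mainTheorem3 : (p : ℕ) → Prime p → (r : ℕ) →
    ((μ : List ℕ) → PartitionAtMost r μ → 0ℚ ≤ weight p r μ)
    × ((L : List (List ℕ)) → Unique L → All (PartitionAtMost r) L →
         sumℚ (map (weight p r) L) ≤ 1ℚ)
    × ((ε : ℚ) → 0ℚ < ε →
         ∃[ L ] (Unique L × All (PartitionAtMost r) L
                 × 1ℚ - ε < sumℚ (map (weight p r) L)))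
mainTheorem3 p p-prime r = (λ μ _ → 0≤weight μ) , sum≤1 , sum→1
  where
  open PrimeWeights p (ℕ.nonTrivial⇒n>1 p {{prime⇒nonTrivial p-prime}})
  open Truncation r

  0≤weight : ∀ μ → 0ℚ ≤ weight p r μ
  0≤weight μ = <⇒≤ (weight-pos r μ)

  sum≤1 : ∀ L → Unique L → All (PartitionAtMost r) L → sumℚ (map (weight p r) L) ≤ 1ℚ
  sum≤1 L unique atMost = begin
    sumℚ (map (weight p r) L)                            ≤⟨ sumℚ-map-mono-⊆ (weight p r) 0≤weight unique (boundedPartitionsUpTo-covers r atMost) ⟩
    sumℚ (map (weight p r) (boundedPartitionsUpTo N r))  ≡⟨ boundedPartitionsUpTo-weight-sum r N r ⟩
    sumUpTo r (λ a → lengthFactor r a * truncated N a)   ≤⟨ lengthFactor-truncated-sum≤1 N ⟩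
    1ℚ                                                   ∎
    where
    open ≤-Reasoning
    N = size (map size L)

  sum→1 : ∀ ε → 0ℚ < ε → ∃[ L ] (Unique L × All (PartitionAtMost r) L × 1ℚ - ε < sumℚ (map (weight p r) L))
  sum→1 ε 0<ε = boundedPartitionsUpTo N r , boundedPartitionsUpTo-unique N r , boundedPartitionsUpTo-atMost N r , (begin-strict
    1ℚ - ε                                               <⟨ +-monoʳ-< 1ℚ (neg-antimono-< ρᴺ<ε) ⟩
    1ℚ - ρ ^ N                                           ≤⟨ 1-ρᴺ≤lengthFactor-truncated-sum N ⟩
    sumUpTo r (λ a → lengthFactor r a * truncated N a)   ≡⟨ boundedPartitionsUpTo-weight-sum r N r ⟨
    sumℚ (map (weight p r) (boundedPartitionsUpTo N r))  ∎)
    where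
    open ≤-Reasoning
    N : ℕ
    N = proj₁ (geometric-small (poch-pos r) (poch-≤1 r) 0<ε)
    ρᴺ<ε : ρ ^ N < ε
    ρᴺ<ε = proj₂ (geometric-small (poch-pos r) (poch-≤1 r) 0<ε)
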